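{- Let $n\ge 3$, $\lambda=(1^{a_1},2^{a_2},\ldots,n^{a_n})\vdash n$, and let $X=\sum_{1\leq i<j\leq n} \mathrm{wt}(i,j) I_{i,j}$ be a weighted inversion statistic. Set $\alpha_n(X)=\sum_{1\leq i<j\leq n} \mathrm{wt}(i,j)$ and $\beta_n(X)=\sum_{1\leq i<j\leq n} (j-i-1)\, \mathrm{wt}(i,j)$. Then \[\mathbb{E}_{\lambda}[X]=\left(\frac{1}{2}+\frac{a_2}{n(n-1)}-\frac{a_1(a_1-1)}{2n(n-1)}\right) \alpha_n(X)+\left(\frac{n-n a_1-a_1+a_1^2-2a_2}{n(n-1)(n-2)}\right) \beta_n(X).\]
   Context: $S_n$ is the symmetric group on $[n]$; $C_\lambda$ is the conjugacy class of permutations of cycle type $\lambda$ and $\mathbb{E}_\lambda$ is expectation under the uniform measure on $C_\lambda$. The notation $\lambda=(1^{a_1},\ldots,n^{a_n})$ means $\lambda$ has exactly $a_r$ parts equal to $r$. For $1\le i<j\le n$, $I_{i,j}(\omega)=1$ if $\omega(i)>\omega(j)$ and $0$ otherwise. A weighted inversion statistic is a function $\sum_{1\le i<j\le n}\mathrm{wt}(i,j)I_{i,j}$ on $S_n$ with real weights $\mathrm{wt}(i,j)$.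
   Formalization: The weights $\mathrm{wt}(i,j)$ of the weighted inversion statistic are rational numbers rather than real ones. -}

module Defs where

open import Data.Nat as ℕ using (ℕ; zero; suc)
open import Data.Fin as Fin using (Fin; toℕ)
open import Data.Fin.Properties using (_≟_)
open import Data.Integer using (+_)
open import Data.Rational using (ℚ; _/_; 0ℚ; _+_; _*_; _-_)
open import Data.List using (List; []; _∷_; map; filter; length; concatMap; foldr; allFin; upTo)
open import Data.Product using (_×_; _,_)
open import Data.Bool using (Bool; true; false; if_then_else_)
open import Relation.Nullary using (does; Dec; yes; no)
open import Relation.Nullary.Decidable using (⌊_⌋)
open import Relation.Binary.PropositionalEquality using (_≡_)

ℕ→ℚ : ℕ → ℚ
ℕ→ℚ k = + k / 1

-- division of a rational by a natural number (by 0 gives 0; only used with nonzero denominators)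
_/ℕ_ : ℚ → ℕ → ℚ
x /ℕ zero = 0ℚ
x /ℕ suc k = x * (+ 1 / suc k)

sumℚ : List ℚ → ℚ
sumℚ = foldr _+_ 0ℚ

-- arithmetic mean of a list (0 for the empty list)
mean : List ℚ → ℚ
mean xs = sumℚ xs /ℕ length xs

allFuns : (n m : ℕ) → List (Fin n → Fin m)
allFuns zero m = (λ ()) ∷ []
allFuns (suc n) m =
  concatMap (λ k → map (λ f → λ { Fin.zero → k ; (Fin.suc i) → f i }) (allFuns n m)) (allFin m)

pairs : (n : ℕ) → List (Fin n × Fin n)
pairs n = concatMap (λ i → map (λ j → (i , j)) (filter (λ j → i Fin.<? j) (allFin n))) (allFin n)

isInjective : {n : ℕ} → (Fin n → Fin n) → Bool
isInjective {n} ω =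
  Data.Bool.ListAction.and (map (λ { (i , j) → Data.Bool.not ⌊ ω i ≟ ω j ⌋ }) (pairs n))
  where import Data.Bool.ListAction ; import Data.Bool

Sym : (n : ℕ) → List (Fin n → Fin n)
Sym n = filter (λ ω → isInjective ω Data.Bool.≟ true) (allFuns n n)
  where import Data.Bool

iter : {n : ℕ} → (Fin n → Fin n) → ℕ → Fin n → Fin n
iter ω zero i = i
iter ω (suc k) i = ω (iter ω k i)

cycLen : {n : ℕ} → (Fin n → Fin n) → Fin n → ℕ
cycLen {n} ω i = go (Data.List.map suc (upTo n))
  where
  import Data.List
  go : List ℕ → ℕ
  go [] = 0
  go (k ∷ ks) = if ⌊ iter ω k i ≟ i ⌋ then k else go ks

count : {A : Set} → (A → Bool) → List A → ℕ
count p xs = length (filter (λ x → p x Data.Bool.≟ true) xs)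
  where import Data.Bool

-- ω has cycle type (1^{a 1}, ..., n^{a n}): for each r in 1..n exactly a r cycles of
-- length r, i.e. exactly r * a r points lie on cycles of length r
hasCycleType : {n : ℕ} → (ℕ → ℕ) → (Fin n → Fin n) → Bool
hasCycleType {n} a ω =
  Data.Bool.ListAction.and (Data.List.map
    (λ r → ⌊ count (λ i → ⌊ cycLen ω i ℕ.≟ r ⌋) (allFin n) ℕ.≟ r ℕ.* a r ⌋)
    (Data.List.map suc (upTo n)))
  where import Data.List ; import Data.Bool.ListAction

ConjClass : (n : ℕ) → (ℕ → ℕ) → List (Fin n → Fin n)
ConjClass n a = filter (λ ω → hasCycleType a ω Data.Bool.≟ true) (Sym n)
  where import Data.Bool

IsPartitionOf : (ℕ → ℕ) → ℕ → Set
IsPartitionOf a n = Data.Nat.ListAction.sum (Data.List.map (λ r → r ℕ.* a r) (Data.List.map suc (upTo n))) ≡ n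
  where import Data.List ; import Data.Nat.ListAction

I : {n : ℕ} → Fin n → Fin n → (Fin n → Fin n) → ℚ
I i j ω = if ⌊ ω j Fin.<? ω i ⌋ then ℕ→ℚ 1 else 0ℚ

X : {n : ℕ} → (Fin n → Fin n → ℚ) → (Fin n → Fin n) → ℚ
X {n} wt ω = sumℚ (map (λ { (i , j) → wt i j * I i j ω }) (pairs n))

Eλ : (n : ℕ) → (ℕ → ℕ) → ((Fin n → Fin n) → ℚ) → ℚ
Eλ n a Y = mean (map Y (ConjClass n a))

α : {n : ℕ} → (Fin n → Fin n → ℚ) → ℚ
α {n} wt = sumℚ (map (λ { (i , j) → wt i j }) (pairs n))

β : {n : ℕ} → (Fin n → Fin n → ℚ) → ℚ
β {n} wt = sumℚ (map (λ { (i , j) → ℕ→ℚ (toℕ j ℕ.∸ toℕ i ℕ.∸ 1) * wt i j }) (pairs n))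

module Submission where

-- Fix i < j and let N k l be the number of ω in the class with ω i = k and ω j = l. Conjugating
-- by a transposition preserves the class, so N k l only depends on the position of k and l
-- relative to i and j: for l ∉ {i, j} one has N i l = N l j = P₁ and N j l = N l i = P₂, and N is
-- symmetric on the block of rows and columns outside {i, j}. Hence #{ω j < ω i} = Σ_{l<k} N k l
-- and #{ω j > ω i} = Σ_{k<l} N k l differ only by terms outside that block, whose multiplicities
-- count positions below and above i and j; as the two add up to |C|, this gives
-- 2 · #{ω j < ω i} = |C| + N j i − N i j + 2 (j − i − 1) (P₂ − P₁). Summing N over one coordinate
-- and using that every ω has a₁ fixed points and a₁ + 2 a₂ points with ω (ω x) = x expresses
-- N i j, N j i, P₁ and P₂ through |C|, n, a₁ and a₂; the theorem follows by summing the
-- resulting inversion probabilities against wt.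

open import Algebra.Bundles using (CommutativeSemiring; CommutativeRing)
open import Data.Bool using (Bool; true; false; if_then_else_)
import Data.Bool as Bool
import Data.Bool.ListAction as Bool
open import Data.Bool.Properties using (T-≡)
open import Data.Empty using (⊥; ⊥-elim)
open import Data.Fin as Fin using (Fin; toℕ; _↑ˡ_; _↑ʳ_; splitAt; join)
import Data.Fin.Permutation as Permutation
open import Data.Fin.Permutation.Components using (transpose)
open import Data.Fin.Properties using (_≟_; _<?_; all?)
import Data.Fin.Properties as Finₚ
open import Data.List using (List; []; _∷_; map; foldr; filter; length; _++_; concatMap; tabulate; allFin; upTo; applyUpTo; replicate)
open import Data.List.Membership.Propositional using (_∈_; find; lose)
open import Data.List.Membership.Propositional.Properties using (∈-map⁺; ∈-map⁻; ∈-concatMap⁺; ∈-concatMap⁻; ∈-filter⁺; ∈-filter⁻; ∈-allFin; ∈-applyUpTo⁻; ∈-upTo⁺; ∈-upTo⁻)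
open import Data.List.Properties using (map-upTo; map-cong; length-map)
import Data.List.Relation.Unary.All as All
open import Data.List.Relation.Unary.All.Properties using (all⁺; all⁻)
open import Data.List.Relation.Unary.Any using (here; there)
open import Data.Nat using (ℕ; zero; suc; _≤_; _<_; _∸_; z≤n; s≤s; s≤s⁻¹)
import Data.Nat as ℕ
import Data.Nat.Properties as ℕₚ
open import Data.Product using (_×_; _,_; Σ; ∃; proj₁; proj₂)
open import Data.Rational using (ℚ; 0ℚ; 1ℚ)
import Data.Rational.Properties as ℚₚ
open import Data.Sum using (_⊎_; inj₁; inj₂; [_,_]′)
import Data.Sum as Sum
open import Function using (_∘_; flip; _⇔_; mk⇔; Equivalence)
open import Function.Definitions using (Injective)
open import Relation.Binary.Definitions using (tri<; tri≈; tri>)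
open import Relation.Binary.PropositionalEquality
open import Relation.Nullary using (Dec; yes; no; ¬_)
open import Relation.Nullary.Decidable using (⌊_⌋; _×-dec_; ¬?; dec-true; dec-false; toWitness; fromWitness; toWitnessFalse; fromWitnessFalse)
open import Relation.Unary using (Pred; Decidable)
open import Defs

module ListSum {c ℓ} (R : CommutativeSemiring c ℓ) where

  open CommutativeSemiring R
    using (Carrier; _≈_; _+_; _*_; 0#; +-cong; +-congˡ; +-identityˡ; +-assoc; +-commutativeMonoid; zeroʳ; distribˡ; *-comm)
    renaming (refl to ≈-refl; sym to ≈-sym; trans to ≈-trans)
  open import Relation.Binary.Reasoning.Setoid (CommutativeSemiring.setoid R)
  open import Algebra.Properties.Semiring.Sum (CommutativeSemiring.semiring R) using (sum; sum-syntax)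
  open import Algebra.Solver.CommutativeMonoid +-commutativeMonoid using (solve; _⊕_; _⊜_)

  ∑ˡ : ∀ {a} {A : Set a} → List A → (A → Carrier) → Carrier
  ∑ˡ xs f = foldr _+_ 0# (map f xs)

  module _ {a} {A : Set a} where

    ∑ˡ-cong-∈ : (xs : List A) {f g : A → Carrier} → (∀ {x} → x ∈ xs → f x ≈ g x) → ∑ˡ xs f ≈ ∑ˡ xs g
    ∑ˡ-cong-∈ [] e = ≈-refl
    ∑ˡ-cong-∈ (x ∷ xs) e = +-cong (e (here refl)) (∑ˡ-cong-∈ xs (λ x∈ → e (there x∈)))

    ∑ˡ-cong : (xs : List A) {f g : A → Carrier} → (∀ x → f x ≈ g x) → ∑ˡ xs f ≈ ∑ˡ xs g
    ∑ˡ-cong xs e = ∑ˡ-cong-∈ xs (λ {x} _ → e x)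

    ∑ˡ-0 : (xs : List A) → ∑ˡ xs (λ _ → 0#) ≈ 0#
    ∑ˡ-0 [] = ≈-refl
    ∑ˡ-0 (x ∷ xs) = ≈-trans (+-identityˡ _) (∑ˡ-0 xs)

    ∑ˡ-+ : (xs : List A) (f g : A → Carrier) → ∑ˡ xs (λ x → f x + g x) ≈ ∑ˡ xs f + ∑ˡ xs g
    ∑ˡ-+ [] f g = ≈-sym (+-identityˡ 0#)
    ∑ˡ-+ (x ∷ xs) f g = begin
      (f x + g x) + ∑ˡ xs (λ y → f y + g y) ≈⟨ +-congˡ (∑ˡ-+ xs f g) ⟩
      (f x + g x) + (∑ˡ xs f + ∑ˡ xs g)     ≈⟨ solve 4 (λ a b c d → (a ⊕ b) ⊕ (c ⊕ d) ⊜ (a ⊕ c) ⊕ (b ⊕ d)) ≈-refl (f x) (g x) (∑ˡ xs f) (∑ˡ xs g) ⟩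
      (f x + ∑ˡ xs f) + (g x + ∑ˡ xs g)     ∎

    ∑ˡ-*ˡ : (xs : List A) (k : Carrier) (f : A → Carrier) → ∑ˡ xs (λ x → k * f x) ≈ k * ∑ˡ xs f
    ∑ˡ-*ˡ [] k f = ≈-sym (zeroʳ k)
    ∑ˡ-*ˡ (x ∷ xs) k f = ≈-trans (+-congˡ (∑ˡ-*ˡ xs k f)) (≈-sym (distribˡ k (f x) (∑ˡ xs f)))

    ∑ˡ-*ʳ : (xs : List A) (k : Carrier) (f : A → Carrier) → ∑ˡ xs (λ x → f x * k) ≈ ∑ˡ xs f * k
    ∑ˡ-*ʳ xs k f = ≈-trans (∑ˡ-cong xs (λ x → *-comm (f x) k)) (≈-trans (∑ˡ-*ˡ xs k f) (*-comm k (∑ˡ xs f)))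

    ∑ˡ-++ : (xs ys : List A) (f : A → Carrier) → ∑ˡ (xs ++ ys) f ≈ ∑ˡ xs f + ∑ˡ ys f
    ∑ˡ-++ [] ys f = ≈-sym (+-identityˡ _)
    ∑ˡ-++ (x ∷ xs) ys f = ≈-trans (+-congˡ (∑ˡ-++ xs ys f)) (≈-sym (+-assoc (f x) (∑ˡ xs f) (∑ˡ ys f)))

    ∑ˡ-∑ : ∀ {n} (xs : List A) (g : A → Fin n → Carrier) →
      ∑ˡ xs (λ x → ∑[ i < n ] g x i) ≈ ∑[ i < n ] ∑ˡ xs (λ x → g x i)
    ∑ˡ-∑ {zero} xs g = ∑ˡ-0 xs
    ∑ˡ-∑ {suc n} xs g = begin
      ∑ˡ xs (λ x → g x Fin.zero + ∑[ i < n ] g x (Fin.suc i))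
        ≈⟨ ∑ˡ-+ xs (λ x → g x Fin.zero) (λ x → ∑[ i < n ] g x (Fin.suc i)) ⟩
      ∑ˡ xs (λ x → g x Fin.zero) + ∑ˡ xs (λ x → ∑[ i < n ] g x (Fin.suc i))
        ≈⟨ +-congˡ (∑ˡ-∑ xs (λ x i → g x (Fin.suc i))) ⟩
      ∑ˡ xs (λ x → g x Fin.zero) + ∑[ i < n ] ∑ˡ xs (λ x → g x (Fin.suc i)) ∎

  module _ {a b} {A : Set a} {B : Set b} where

    ∑ˡ-map : (h : A → B) (xs : List A) (f : B → Carrier) → ∑ˡ (map h xs) f ≈ ∑ˡ xs (λ x → f (h x))
    ∑ˡ-map h [] f = ≈-refl
    ∑ˡ-map h (x ∷ xs) f = +-congˡ (∑ˡ-map h xs f)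

    ∑ˡ-concatMap : (h : A → List B) (xs : List A) (f : B → Carrier) →
      ∑ˡ (concatMap h xs) f ≈ ∑ˡ xs (λ x → ∑ˡ (h x) f)
    ∑ˡ-concatMap h [] f = ≈-refl
    ∑ˡ-concatMap h (x ∷ xs) f = ≈-trans (∑ˡ-++ (h x) (concatMap h xs) f) (+-congˡ (∑ˡ-concatMap h xs f))

    ∑ˡ-comm : (xs : List A) (ys : List B) (g : A → B → Carrier) →
      ∑ˡ xs (λ x → ∑ˡ ys (g x)) ≈ ∑ˡ ys (λ y → ∑ˡ xs (λ x → g x y))
    ∑ˡ-comm [] ys g = ≈-sym (∑ˡ-0 ys)
    ∑ˡ-comm (x ∷ xs) ys g = ≈-trans (+-congˡ (∑ˡ-comm xs ys g)) (≈-sym (∑ˡ-+ ys (g x) (λ y → ∑ˡ xs (λ x′ → g x′ y))))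

  ∑ˡ-tabulate : ∀ {a} {A : Set a} {n} (h : Fin n → A) (f : A → Carrier) → ∑ˡ (tabulate h) f ≈ ∑[ i < n ] f (h i)
  ∑ˡ-tabulate {n = zero} h f = ≈-refl
  ∑ˡ-tabulate {n = suc n} h f = +-congˡ (∑ˡ-tabulate (λ i → h (Fin.suc i)) f)

module ℕΣ = ListSum ℕₚ.+-*-commutativeSemiring
module ℚΣ = ListSum (CommutativeRing.commutativeSemiring ℚₚ.+-*-commutativeRing)

module _ where

  open Data.Nat using (_+_; _*_)
  open import Data.Nat.Properties hiding (_≟_; _<?_)
  open import Data.Nat.DivMod using (_%_; m%n<n; m<n⇒m%n≡m; %-distribˡ-+; m%n%n≡m%n; [m+n]%n≡m%n; m≤n⇒[n∸m]%m≡n%m)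
  open import Data.Nat.Tactic.RingSolver using (solve-∀)
  open import Algebra.Properties.Semiring.Sum +-*-semiring
    using (sum; sum-syntax; ∑-distrib-+; ∑-comm; *-distribˡ-sum; *-distribʳ-sum; sum-cong-≗; sum-permute)
  open ℕΣ

  𝟙 : ∀ {p} {P : Set p} → Dec P → ℕ
  𝟙 (yes _) = 1
  𝟙 (no _) = 0

  module _ {p} {P : Set p} where

    𝟙-yes : (d : Dec P) → P → 𝟙 d ≡ 1
    𝟙-yes (yes _) _ = refl
    𝟙-yes (no ¬p) p = ⊥-elim (¬p p)

    𝟙-no : (d : Dec P) → ¬ P → 𝟙 d ≡ 0
    𝟙-no (yes p) ¬p = ⊥-elim (¬p p)
    𝟙-no (no _) _ = refl

    𝟙-idem : (d : Dec P) → 𝟙 d * 𝟙 d ≡ 𝟙 d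
    𝟙-idem (yes _) = refl
    𝟙-idem (no _) = refl

  module _ {p q} {P : Set p} {Q : Set q} where

    𝟙-cong : (d : Dec P) (e : Dec Q) → (P → Q) → (Q → P) → 𝟙 d ≡ 𝟙 e
    𝟙-cong (yes _) (yes _) _ _ = refl
    𝟙-cong (yes p) (no ¬q) f _ = ⊥-elim (¬q (f p))
    𝟙-cong (no ¬p) (yes q) _ g = ⊥-elim (¬p (g q))
    𝟙-cong (no _) (no _) _ _ = refl

    𝟙-× : (d : Dec P) (e : Dec Q) → 𝟙 (d ×-dec e) ≡ 𝟙 d * 𝟙 e
    𝟙-× (yes _) (yes _) = refl
    𝟙-× (yes _) (no _) = refl
    𝟙-× (no _) _ = refl

  ∑-cong : ∀ {n} {f g : Fin n → ℕ} → (∀ i → f i ≡ g i) → sum f ≡ sum g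
  ∑-cong = sum-cong-≗

  ∑-const : ∀ n (c : ℕ) → ∑[ i < n ] c ≡ n * c
  ∑-const zero c = refl
  ∑-const (suc n) c = cong (c +_) (∑-const n c)

  ∑-𝟙-≟ : ∀ {n} (x : Fin n) (h : Fin n → ℕ) → ∑[ l < n ] (𝟙 (l ≟ x) * h l) ≡ h x
  ∑-𝟙-≟ {suc n} Fin.zero h = begin
    1 * h Fin.zero + ∑[ l < n ] (𝟙 (Fin.suc l ≟ Fin.zero) * h (Fin.suc l))
      ≡⟨ cong₂ _+_ (*-identityˡ _) (∑-cong {n} {g = λ _ → 0} (λ l → cong (_* h (Fin.suc l)) (𝟙-no (Fin.suc l ≟ Fin.zero) λ ()))) ⟩
    h Fin.zero + ∑[ l < n ] 0 ≡⟨ cong (h Fin.zero +_) (∑-const n 0) ⟩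
    h Fin.zero + n * 0 ≡⟨ cong (h Fin.zero +_) (*-zeroʳ n) ⟩
    h Fin.zero + 0 ≡⟨ +-identityʳ _ ⟩
    h Fin.zero ∎
    where open ≡-Reasoning
  ∑-𝟙-≟ {suc n} (Fin.suc x) h = cong₂ _+_
    (cong (_* h Fin.zero) (𝟙-no (Fin.zero ≟ Fin.suc x) λ ()))
    (trans (∑-cong (λ l → cong (_* h (Fin.suc l)) (𝟙-cong (Fin.suc l ≟ Fin.suc x) (l ≟ x) Finₚ.suc-injective (cong Fin.suc))))
           (∑-𝟙-≟ x (λ l → h (Fin.suc l))))

  ∑-𝟙-≟′ : ∀ {n} (x : Fin n) (h : Fin n → ℕ) → ∑[ l < n ] (𝟙 (x ≟ l) * h l) ≡ h x
  ∑-𝟙-≟′ x h = trans (∑-cong (λ l → cong (_* h l) (𝟙-cong (x ≟ l) (l ≟ x) sym sym))) (∑-𝟙-≟ x h)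

  ∑-𝟙-≟-one : ∀ {n} (x : Fin n) → ∑[ l < n ] 𝟙 (x ≟ l) ≡ 1
  ∑-𝟙-≟-one x = trans (∑-cong (λ l → sym (*-identityʳ (𝟙 (x ≟ l))))) (∑-𝟙-≟′ x (λ _ → 1))

  ∑-𝟙-< : ∀ {n} (x : Fin n) → ∑[ l < n ] 𝟙 (l <? x) ≡ toℕ x
  ∑-𝟙-< {suc n} Fin.zero = trans (∑-cong {suc n} {g = λ _ → 0} (λ l → 𝟙-no (l <? Fin.zero {n}) λ ())) (trans (∑-const (suc n) 0) (*-zeroʳ n))
  ∑-𝟙-< {suc n} (Fin.suc x) = cong suc
    (trans (∑-cong {n} {g = λ l → 𝟙 (l <? x)} (λ l → 𝟙-cong (Fin.suc l <? Fin.suc x) (l <? x) s≤s⁻¹ s≤s)) (∑-𝟙-< x))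

  ∑-𝟙-> : ∀ {n} (x : Fin n) → ∑[ l < n ] 𝟙 (x <? l) + suc (toℕ x) ≡ n
  ∑-𝟙-> {suc n} Fin.zero = begin
    0 + ∑[ l < n ] 𝟙 (Fin.zero {n} <? Fin.suc l) + 1 ≡⟨ cong (_+ 1) (trans (∑-cong {n} {g = λ _ → 1} (λ l → 𝟙-yes (Fin.zero {n} <? Fin.suc l) (s≤s z≤n))) (∑-const n 1)) ⟩
    n * 1 + 1 ≡⟨ cong (_+ 1) (*-identityʳ n) ⟩
    n + 1 ≡⟨ +-comm n 1 ⟩
    suc n ∎
    where open ≡-Reasoning
  ∑-𝟙-> {suc n} (Fin.suc x) = begin
    0 + ∑[ l < n ] 𝟙 (Fin.suc x <? Fin.suc l) + suc (suc (toℕ x))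
      ≡⟨ cong (_+ suc (suc (toℕ x))) (∑-cong {n} {g = λ l → 𝟙 (x <? l)} (λ l → 𝟙-cong (Fin.suc x <? Fin.suc l) (x <? l) s≤s⁻¹ s≤s)) ⟩
    ∑[ l < n ] 𝟙 (x <? l) + suc (suc (toℕ x)) ≡⟨ +-suc _ _ ⟩
    suc (∑[ l < n ] 𝟙 (x <? l) + suc (toℕ x)) ≡⟨ cong suc (∑-𝟙-> x) ⟩
    suc n ∎
    where open ≡-Reasoning

  Outside : ∀ {n} → Fin n → Fin n → Fin n → Set
  Outside i j l = l ≢ i × l ≢ j

  outside? : ∀ {n} (i j l : Fin n) → Dec (Outside i j l)
  outside? i j l = ¬? (l ≟ i) ×-dec ¬? (l ≟ j)

  outsidePoint : ∀ {m} (i j : Fin (suc (suc (suc m)))) → Σ (Fin (suc (suc (suc m)))) (Outside i j)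
  outsidePoint i j with Fin.zero ≟ i | Fin.zero ≟ j
  ... | no 0≢i | no 0≢j = Fin.zero , 0≢i , 0≢j
  ... | yes refl | yes refl = Fin.suc Fin.zero , (λ ()) , (λ ())
  ... | yes refl | no _ with j ≟ Fin.suc Fin.zero
  ...   | yes refl = Fin.suc (Fin.suc Fin.zero) , (λ ()) , (λ ())
  ...   | no j≢1 = Fin.suc Fin.zero , (λ ()) , (λ e → j≢1 (sym e))
  outsidePoint i j | no _ | yes refl with i ≟ Fin.suc Fin.zero
  ...   | yes refl = Fin.suc (Fin.suc Fin.zero) , (λ ()) , (λ ())
  ...   | no i≢1 = Fin.suc Fin.zero , (λ e → i≢1 (sym e)) , (λ ())

  𝟙-partition₃ : ∀ {n} {i j : Fin n} → i ≢ j → ∀ l (x : ℕ) →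
    x ≡ 𝟙 (l ≟ i) * x + 𝟙 (l ≟ j) * x + 𝟙 (outside? i j l) * x
  𝟙-partition₃ {i = i} {j} i≢j l x with l ≟ i | l ≟ j
  ... | yes refl | yes refl = ⊥-elim (i≢j refl)
  ... | yes _ | no _ = sym (trans (+-identityʳ (1 * x + 0)) (trans (+-identityʳ (1 * x)) (*-identityˡ x)))
  ... | no _ | yes _ = sym (trans (+-identityʳ (1 * x)) (*-identityˡ x))
  ... | no _ | no _ = sym (*-identityˡ x)

  ∑-split₂ : ∀ {n} {i j : Fin n} → i ≢ j → (h : Fin n → ℕ) →
    ∑[ l < n ] h l ≡ h i + h j + ∑[ l < n ] (𝟙 (outside? i j l) * h l)
  ∑-split₂ {n} {i} {j} i≢j h = begin
    ∑[ l < n ] h l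
      ≡⟨ ∑-cong (λ l → 𝟙-partition₃ i≢j l (h l)) ⟩
    ∑[ l < n ] (𝟙 (l ≟ i) * h l + 𝟙 (l ≟ j) * h l + 𝟙 (outside? i j l) * h l)
      ≡⟨ ∑-distrib-+ (λ l → 𝟙 (l ≟ i) * h l + 𝟙 (l ≟ j) * h l) (λ l → 𝟙 (outside? i j l) * h l) ⟩
    ∑[ l < n ] (𝟙 (l ≟ i) * h l + 𝟙 (l ≟ j) * h l) + ∑[ l < n ] (𝟙 (outside? i j l) * h l)
      ≡⟨ cong (_+ rest) (∑-distrib-+ (λ l → 𝟙 (l ≟ i) * h l) (λ l → 𝟙 (l ≟ j) * h l)) ⟩
    ∑[ l < n ] (𝟙 (l ≟ i) * h l) + ∑[ l < n ] (𝟙 (l ≟ j) * h l) + ∑[ l < n ] (𝟙 (outside? i j l) * h l)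
      ≡⟨ cong₂ (λ x y → x + y + rest) (∑-𝟙-≟ i h) (∑-𝟙-≟ j h) ⟩
    h i + h j + rest ∎
    where
    open ≡-Reasoning
    rest = ∑[ l < n ] (𝟙 (outside? i j l) * h l)

  ∑-outside-cong : ∀ {n} {i j : Fin n} {f g : Fin n → ℕ} → (∀ l → Outside i j l → f l ≡ g l) →
    ∑[ l < n ] (𝟙 (outside? i j l) * f l) ≡ ∑[ l < n ] (𝟙 (outside? i j l) * g l)
  ∑-outside-cong {i = i} {j} {f} {g} e = ∑-cong λ l → lemma l (outside? i j l)
    where
    lemma : ∀ l (d : Dec (Outside i j l)) → 𝟙 d * f l ≡ 𝟙 d * g l
    lemma l (yes o) = cong (1 *_) (e l o)
    lemma l (no _) = refl

  ∑-outside-const : ∀ {n} {i j : Fin n} (w f : Fin n → ℕ) (c : ℕ) → (∀ l → Outside i j l → f l ≡ c) →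
    ∑[ l < n ] (𝟙 (outside? i j l) * (w l * f l)) ≡ ∑[ l < n ] (𝟙 (outside? i j l) * w l) * c
  ∑-outside-const {n} {i} {j} w f c f≡c = begin
    ∑[ l < n ] (𝟙 (outside? i j l) * (w l * f l)) ≡⟨ ∑-outside-cong (λ l o → cong (w l *_) (f≡c l o)) ⟩
    ∑[ l < n ] (𝟙 (outside? i j l) * (w l * c)) ≡⟨ ∑-cong (λ l → sym (*-assoc (𝟙 (outside? i j l)) (w l) c)) ⟩
    ∑[ l < n ] (𝟙 (outside? i j l) * w l * c) ≡⟨ sym (*-distribʳ-sum c (λ l → 𝟙 (outside? i j l) * w l)) ⟩
    ∑[ l < n ] (𝟙 (outside? i j l) * w l) * c ∎
    where open ≡-Reasoning

  ∑-outside-count : ∀ {n} {i j : Fin n} → i ≢ j → ∑[ l < n ] 𝟙 (outside? i j l) + 2 ≡ n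
  ∑-outside-count {n} {i} {j} i≢j = begin
    ∑[ l < n ] 𝟙 (outside? i j l) + 2 ≡⟨ +-comm _ 2 ⟩
    1 + 1 + ∑[ l < n ] 𝟙 (outside? i j l) ≡⟨ cong (2 +_) (∑-cong (λ l → sym (*-identityʳ (𝟙 (outside? i j l))))) ⟩
    1 + 1 + ∑[ l < n ] (𝟙 (outside? i j l) * 1) ≡⟨ sym (∑-split₂ i≢j (λ _ → 1)) ⟩
    ∑[ l < n ] 1 ≡⟨ ∑-const n 1 ⟩
    n * 1 ≡⟨ *-identityʳ n ⟩
    n ∎
    where open ≡-Reasoning

  ∑-split₂-const : ∀ {m} {i j : Fin (suc (suc m))} → i ≢ j → (h : Fin (suc (suc m)) → ℕ) (c : ℕ) →
    (∀ l → Outside i j l → h l ≡ c) → ∑[ l < suc (suc m) ] h l ≡ h i + h j + m * c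
  ∑-split₂-const {m} {i} {j} i≢j h c h≡c = begin
    ∑[ l < suc (suc m) ] h l ≡⟨ ∑-split₂ i≢j h ⟩
    h i + h j + ∑[ l < suc (suc m) ] (𝟙 (outside? i j l) * h l) ≡⟨ cong (h i + h j +_) (∑-outside-cong h≡c) ⟩
    h i + h j + ∑[ l < suc (suc m) ] (𝟙 (outside? i j l) * c) ≡⟨ cong (h i + h j +_) (*-distribʳ-sum c (λ l → 𝟙 (outside? i j l))) ⟨
    h i + h j + ∑[ l < suc (suc m) ] 𝟙 (outside? i j l) * c ≡⟨ cong (λ k → h i + h j + k * c) outside-count ⟩
    h i + h j + m * c ∎
    where
    open ≡-Reasoning
    outside-count : ∑[ l < suc (suc m) ] 𝟙 (outside? i j l) ≡ m
    outside-count = +-cancelʳ-≡ 2 _ m (trans (∑-outside-count i≢j) (+-comm 2 m))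

  module _ {a p} {A : Set a} {P : Pred A p} where

    ∑ˡ-filter : (P? : Decidable P) (xs : List A) (f : A → ℕ) → ∑ˡ (filter P? xs) f ≡ ∑ˡ xs (λ x → 𝟙 (P? x) * f x)
    ∑ˡ-filter P? [] f = refl
    ∑ˡ-filter P? (x ∷ xs) f with P? x
    ... | yes _ = cong₂ _+_ (sym (+-identityʳ (f x))) (∑ˡ-filter P? xs f)
    ... | no _ = ∑ˡ-filter P? xs f

  module _ {a} {A : Set a} where

    length≡∑ˡ : (xs : List A) → length xs ≡ ∑ˡ xs (λ _ → 1)
    length≡∑ˡ [] = refl
    length≡∑ˡ (x ∷ xs) = cong suc (length≡∑ˡ xs)

    ∑ˡ-mono : (xs : List A) {f g : A → ℕ} → (∀ x → f x ≤ g x) → ∑ˡ xs f ≤ ∑ˡ xs g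
    ∑ˡ-mono [] le = z≤n
    ∑ˡ-mono (x ∷ xs) le = +-mono-≤ (le x) (∑ˡ-mono xs le)

  ∑ˡ-allFin : ∀ {n} (f : Fin n → ℕ) → ∑ˡ (allFin n) f ≡ ∑[ i < n ] f i
  ∑ˡ-allFin f = ∑ˡ-tabulate (λ i → i) f

  count≡∑ : ∀ {n} (p : Fin n → Bool) → count p (allFin n) ≡ ∑[ i < n ] 𝟙 (p i Bool.≟ true)
  count≡∑ {n} p = begin
    length (filter (λ i → p i Bool.≟ true) (allFin n)) ≡⟨ length≡∑ˡ (filter (λ i → p i Bool.≟ true) (allFin n)) ⟩
    ∑ˡ (filter (λ i → p i Bool.≟ true) (allFin n)) (λ _ → 1) ≡⟨ ∑ˡ-filter (λ i → p i Bool.≟ true) (allFin n) (λ _ → 1) ⟩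
    ∑ˡ (allFin n) (λ i → 𝟙 (p i Bool.≟ true) * 1) ≡⟨ ∑ˡ-allFin (λ i → 𝟙 (p i Bool.≟ true) * 1) ⟩
    ∑[ i < n ] (𝟙 (p i Bool.≟ true) * 1) ≡⟨ ∑-cong (λ i → *-identityʳ (𝟙 (p i Bool.≟ true))) ⟩
    ∑[ i < n ] 𝟙 (p i Bool.≟ true) ∎
    where open ≡-Reasoning

  Respects≗ : ∀ {n m} → ((Fin n → Fin m) → ℕ) → Set
  Respects≗ K = ∀ {f g} → f ≗ g → K f ≡ K g

  _≗?_ : ∀ {n m} (f g : Fin n → Fin m) → Dec (f ≗ g)
  f ≗? g = all? (λ i → f i ≟ g i)

  _◂_ : ∀ {n m} → Fin m → (Fin n → Fin m) → Fin (suc n) → Fin m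
  (k ◂ f) Fin.zero = k
  (k ◂ f) (Fin.suc i) = f i

  ∑-allFuns-suc : ∀ {n m} (K : (Fin (suc n) → Fin m) → ℕ) → Respects≗ K →
    ∑ˡ (allFuns (suc n) m) K ≡ ∑[ k < m ] ∑ˡ (allFuns n m) (λ f → K (k ◂ f))
  ∑-allFuns-suc {n} {m} K resp = split _ λ k f → λ { Fin.zero → refl ; (Fin.suc i) → refl }
    where
    -- allFuns extends f by k with an anonymous pattern lambda, which split abstracts over
    split : (c : Fin m → (Fin n → Fin m) → Fin (suc n) → Fin m) → (∀ k f → c k f ≗ k ◂ f) →
      ∑ˡ (concatMap (λ k → map (c k) (allFuns n m)) (allFin m)) K ≡ ∑[ k < m ] ∑ˡ (allFuns n m) (λ f → K (k ◂ f))
    split c c≗◂ = begin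
      ∑ˡ (concatMap (λ k → map (c k) (allFuns n m)) (allFin m)) K
        ≡⟨ ∑ˡ-concatMap (λ k → map (c k) (allFuns n m)) (allFin m) K ⟩
      ∑ˡ (allFin m) (λ k → ∑ˡ (map (c k) (allFuns n m)) K)
        ≡⟨ ∑ˡ-allFin (λ k → ∑ˡ (map (c k) (allFuns n m)) K) ⟩
      ∑[ k < m ] ∑ˡ (map (c k) (allFuns n m)) K
        ≡⟨ ∑-cong (λ k → trans (∑ˡ-map (c k) (allFuns n m) K) (∑ˡ-cong (allFuns n m) λ f → resp (c≗◂ k f))) ⟩
      ∑[ k < m ] ∑ˡ (allFuns n m) (λ f → K (k ◂ f)) ∎
      where open ≡-Reasoning

  𝟙-*-≤ : ∀ {p} {P : Set p} (d : Dec P) (x : ℕ) → 𝟙 d * x ≤ x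
  𝟙-*-≤ (yes _) x = ≤-reflexive (*-identityˡ x)
  𝟙-*-≤ (no _) x = z≤n

  𝟙-≗?-◂ : ∀ {n m} (h : Fin (suc n) → Fin m) k (f : Fin n → Fin m) →
    𝟙 ((k ◂ f) ≗? h) ≡ 𝟙 (k ≟ h Fin.zero) * 𝟙 (f ≗? (h ∘ Fin.suc))
  𝟙-≗?-◂ h k f = trans
    (𝟙-cong ((k ◂ f) ≗? h) ((k ≟ h Fin.zero) ×-dec (f ≗? (h ∘ Fin.suc)))
      (λ e → e Fin.zero , λ i → e (Fin.suc i))
      (λ { (e₀ , e) Fin.zero → e₀ ; (e₀ , e) (Fin.suc i) → e i }))
    (𝟙-× (k ≟ h Fin.zero) (f ≗? (h ∘ Fin.suc)))

  ∑-allFuns-𝟙-≗ : ∀ {n m} (h : Fin n → Fin m) (K : (Fin n → Fin m) → ℕ) → Respects≗ K →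
    ∑ˡ (allFuns n m) (λ g → 𝟙 (g ≗? h) * K g) ≡ K h
  ∑-allFuns-𝟙-≗ {zero} h K resp = begin
    𝟙 ((λ ()) ≗? h) * K (λ ()) + 0 ≡⟨ +-identityʳ _ ⟩
    𝟙 ((λ ()) ≗? h) * K (λ ()) ≡⟨ cong (_* K (λ ())) (𝟙-yes ((λ ()) ≗? h) (λ ())) ⟩
    1 * K (λ ()) ≡⟨ *-identityˡ _ ⟩
    K (λ ()) ≡⟨ resp (λ ()) ⟩
    K h ∎
    where open ≡-Reasoning
  ∑-allFuns-𝟙-≗ {suc n} {m} h K resp = begin
    ∑ˡ (allFuns (suc n) m) (λ g → 𝟙 (g ≗? h) * K g)
      ≡⟨ ∑-allFuns-suc (λ g → 𝟙 (g ≗? h) * K g) (λ {f} {g} e → cong₂ _*_ (𝟙-cong (f ≗? h) (g ≗? h) (λ f≗h i → trans (sym (e i)) (f≗h i)) (λ g≗h i → trans (e i) (g≗h i))) (resp e)) ⟩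
    ∑[ k < m ] ∑ˡ (allFuns n m) (λ f → 𝟙 ((k ◂ f) ≗? h) * K (k ◂ f))
      ≡⟨ ∑-cong (λ k → ∑ˡ-cong (allFuns n m) λ f → trans (cong (_* K (k ◂ f)) (𝟙-≗?-◂ h k f)) (*-assoc (𝟙 (k ≟ h Fin.zero)) (𝟙 (f ≗? tail)) (K (k ◂ f)))) ⟩
    ∑[ k < m ] ∑ˡ (allFuns n m) (λ f → 𝟙 (k ≟ h Fin.zero) * (𝟙 (f ≗? tail) * K (k ◂ f)))
      ≡⟨ ∑-cong (λ k → ∑ˡ-*ˡ (allFuns n m) (𝟙 (k ≟ h Fin.zero)) (λ f → 𝟙 (f ≗? tail) * K (k ◂ f))) ⟩
    ∑[ k < m ] (𝟙 (k ≟ h Fin.zero) * ∑ˡ (allFuns n m) (λ f → 𝟙 (f ≗? tail) * K (k ◂ f)))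
      ≡⟨ ∑-𝟙-≟ (h Fin.zero) (λ k → ∑ˡ (allFuns n m) (λ f → 𝟙 (f ≗? tail) * K (k ◂ f))) ⟩
    ∑ˡ (allFuns n m) (λ f → 𝟙 (f ≗? tail) * K (h Fin.zero ◂ f))
      ≡⟨ ∑-allFuns-𝟙-≗ tail (λ f → K (h Fin.zero ◂ f)) (λ e → resp λ { Fin.zero → refl ; (Fin.suc i) → e i }) ⟩
    K (h Fin.zero ◂ tail)
      ≡⟨ resp (λ { Fin.zero → refl ; (Fin.suc i) → refl }) ⟩
    K h ∎
    where
    open ≡-Reasoning
    tail = h ∘ Fin.suc

  ∑-allFuns-involution : ∀ {n m} (Φ : (Fin n → Fin m) → Fin n → Fin m) →
    (∀ {f g} → f ≗ g → Φ f ≗ Φ g) → (∀ f → Φ (Φ f) ≗ f) →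
    (K : (Fin n → Fin m) → ℕ) → Respects≗ K →
    ∑ˡ (allFuns n m) (λ f → K (Φ f)) ≡ ∑ˡ (allFuns n m) K
  ∑-allFuns-involution {n} {m} Φ Φ-cong Φ-invol K resp = begin
    ∑ˡ AF (λ f → K (Φ f))
      ≡⟨ ∑ˡ-cong AF (λ f → sym (∑-allFuns-𝟙-≗ (Φ f) K resp)) ⟩
    ∑ˡ AF (λ f → ∑ˡ AF (λ g → 𝟙 (g ≗? Φ f) * K g))
      ≡⟨ ∑ˡ-comm AF AF (λ f g → 𝟙 (g ≗? Φ f) * K g) ⟩
    ∑ˡ AF (λ g → ∑ˡ AF (λ f → 𝟙 (g ≗? Φ f) * K g))
      ≡⟨ ∑ˡ-cong AF (λ g → ∑ˡ-cong AF λ f → cong (_* K g) (𝟙-cong (g ≗? Φ f) (f ≗? Φ g) (swap f g) (swap g f))) ⟩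
    ∑ˡ AF (λ g → ∑ˡ AF (λ f → 𝟙 (f ≗? Φ g) * K g))
      ≡⟨ ∑ˡ-cong AF (λ g → ∑ˡ-*ʳ AF (K g) (λ f → 𝟙 (f ≗? Φ g))) ⟩
    ∑ˡ AF (λ g → ∑ˡ AF (λ f → 𝟙 (f ≗? Φ g)) * K g)
      ≡⟨ ∑ˡ-cong AF (λ g → cong (_* K g) (trans (∑ˡ-cong AF (λ f → sym (*-identityʳ (𝟙 (f ≗? Φ g))))) (∑-allFuns-𝟙-≗ (Φ g) (λ _ → 1) (λ _ → refl)))) ⟩
    ∑ˡ AF (λ g → 1 * K g)
      ≡⟨ ∑ˡ-cong AF (λ g → *-identityˡ (K g)) ⟩
    ∑ˡ AF K ∎
    where
    open ≡-Reasoning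
    AF = allFuns n m
    swap : ∀ f g → g ≗ Φ f → f ≗ Φ g
    swap f g g≗Φf i = trans (sym (Φ-invol f i)) (sym (Φ-cong g≗Φf i))

  ∑-allFuns-≥ : ∀ {n m} (K : (Fin n → Fin m) → ℕ) → Respects≗ K → ∀ h → K h ≤ ∑ˡ (allFuns n m) K
  ∑-allFuns-≥ {n} {m} K resp h = begin
    K h ≡⟨ sym (∑-allFuns-𝟙-≗ h K resp) ⟩
    ∑ˡ (allFuns n m) (λ g → 𝟙 (g ≗? h) * K g) ≤⟨ ∑ˡ-mono (allFuns n m) (λ g → 𝟙-*-≤ (g ≗? h) (K g)) ⟩
    ∑ˡ (allFuns n m) K ∎
    where open ≤-Reasoning

  module _ {n} (u v : Fin n) where

    transpose-matchˡ : transpose u v u ≡ v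
    transpose-matchˡ rewrite dec-true (u ≟ u) refl = refl

    transpose-matchʳ : transpose u v v ≡ u
    transpose-matchʳ with v ≟ u
    ... | yes v≡u = v≡u
    ... | no _ rewrite dec-true (v ≟ v) refl = refl

    transpose-fixes : ∀ {k} → k ≢ u → k ≢ v → transpose u v k ≡ k
    transpose-fixes {k} k≢u k≢v rewrite dec-false (k ≟ u) k≢u | dec-false (k ≟ v) k≢v = refl

    transpose-involutive : ∀ k → transpose u v (transpose u v k) ≡ k
    transpose-involutive k = by-cases (k ≟ u) (k ≟ v)
      where
      τ = transpose u v
      by-cases : Dec (k ≡ u) → Dec (k ≡ v) → τ (τ k) ≡ k
      by-cases (yes k≡u) _ = trans (cong (τ ∘ τ) k≡u) (trans (cong τ transpose-matchˡ) (trans transpose-matchʳ (sym k≡u)))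
      by-cases (no _) (yes k≡v) = trans (cong (τ ∘ τ) k≡v) (trans (cong τ transpose-matchʳ) (trans transpose-matchˡ (sym k≡v)))
      by-cases (no k≢u) (no k≢v) = trans (cong τ (transpose-fixes k≢u k≢v)) (transpose-fixes k≢u k≢v)

  conj : ∀ {n} → (Fin n → Fin n) → (Fin n → Fin n) → Fin n → Fin n
  conj τ f = τ ∘ f ∘ τ

  module _ {n} (u v : Fin n) where

    private
      τ = transpose u v
      τ-invol = transpose-involutive u v

    iter-conj : (f : Fin n → Fin n) (k : ℕ) (x : Fin n) → iter (conj τ f) k x ≡ τ (iter f k (τ x))
    iter-conj f zero x = sym (τ-invol x)
    iter-conj f (suc k) x = cong (τ ∘ f) (trans (cong τ (iter-conj f k x)) (τ-invol _))

    iter-conj-returns : (f : Fin n → Fin n) (k : ℕ) (x : Fin n) → iter (conj τ f) k x ≡ x ⇔ iter f k (τ x) ≡ τ x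
    iter-conj-returns f k x = mk⇔
      (λ e → trans (sym (τ-invol _)) (cong τ (trans (sym (iter-conj f k x)) e)))
      (λ e → trans (iter-conj f k x) (trans (cong τ e) (τ-invol x)))

    𝟙-≟-transpose : ∀ x y → 𝟙 (τ x ≟ y) ≡ 𝟙 (x ≟ τ y)
    𝟙-≟-transpose x y = 𝟙-cong (τ x ≟ y) (x ≟ τ y) (λ e → trans (sym (τ-invol x)) (cong τ e)) (λ e → trans (cong τ e) (τ-invol y))

  iter-cong : ∀ {n} {f g : Fin n → Fin n} → f ≗ g → ∀ k x → iter f k x ≡ iter g k x
  iter-cong e zero x = refl
  iter-cong {f = f} e (suc k) x = trans (cong f (iter-cong e k x)) (e _)

  firstReturn : ∀ {n} → (Fin n → Fin n) → Fin n → List ℕ → ℕ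
  firstReturn ω x [] = 0
  firstReturn ω x (k ∷ ks) = if ⌊ iter ω k x ≟ x ⌋ then k else firstReturn ω x ks

  -- cycLen calls a search function local to its where-block; solving the meta below with that
  -- function makes it available for induction.
  private
    mutual
      cycLen-search : ∀ {n} → (Fin n → Fin n) → Fin n → List ℕ → ℕ
      cycLen-search ω x = _

      cycLen-unfold : ∀ {n} (ω : Fin n → Fin n) x → cycLen ω x ≡ cycLen-search ω x (map suc (upTo n))
      cycLen-unfold {n} ω x with map suc (upTo n)
      ... | ks = refl

    cycLen-search≡firstReturn : ∀ {n} (ω : Fin n → Fin n) x ks → cycLen-search ω x ks ≡ firstReturn ω x ks
    cycLen-search≡firstReturn ω x [] = refl
    cycLen-search≡firstReturn ω x (k ∷ ks) = cong (if ⌊ iter ω k x ≟ x ⌋ then k else_) (cycLen-search≡firstReturn ω x ks)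

  cycLen≡firstReturn : ∀ {n} (ω : Fin n → Fin n) x → cycLen ω x ≡ firstReturn ω x (map suc (upTo n))
  cycLen≡firstReturn {n} ω x = trans (cycLen-unfold ω x) (cycLen-search≡firstReturn ω x (map suc (upTo n)))

  firstReturn-cong : ∀ {n} {ω ω′ : Fin n → Fin n} {x x′} →
    (∀ k → iter ω k x ≡ x ⇔ iter ω′ k x′ ≡ x′) → ∀ ks → firstReturn ω x ks ≡ firstReturn ω′ x′ ks
  firstReturn-cong same [] = refl
  firstReturn-cong {ω = ω} {ω′} {x} {x′} same (k ∷ ks) with iter ω k x ≟ x | iter ω′ k x′ ≟ x′
  ... | yes _ | yes _ = refl
  ... | yes p | no ¬q = ⊥-elim (¬q (Equivalence.to (same k) p))
  ... | no ¬p | yes q = ⊥-elim (¬p (Equivalence.from (same k) q))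
  ... | no _ | no _ = firstReturn-cong same ks

  cycLen-conj : ∀ {n} (u v : Fin n) (f : Fin n → Fin n) x → cycLen (conj (transpose u v) f) x ≡ cycLen f (transpose u v x)
  cycLen-conj {n} u v f x = begin
    cycLen (conj (transpose u v) f) x ≡⟨ cycLen≡firstReturn _ x ⟩
    firstReturn (conj (transpose u v) f) x (map suc (upTo n)) ≡⟨ firstReturn-cong (λ k → iter-conj-returns u v f k x) (map suc (upTo n)) ⟩
    firstReturn f (transpose u v x) (map suc (upTo n)) ≡⟨ sym (cycLen≡firstReturn f _) ⟩
    cycLen f (transpose u v x) ∎
    where open ≡-Reasoning

  cycLen-cong : ∀ {n} {f g : Fin n → Fin n} → f ≗ g → ∀ x → cycLen f x ≡ cycLen g x
  cycLen-cong {n} {f} {g} e x = begin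
    cycLen f x ≡⟨ cycLen≡firstReturn f x ⟩
    firstReturn f x (map suc (upTo n)) ≡⟨ firstReturn-cong (λ k → mk⇔ (trans (sym (iter-cong e k x))) (trans (iter-cong e k x))) (map suc (upTo n)) ⟩
    firstReturn g x (map suc (upTo n)) ≡⟨ sym (cycLen≡firstReturn g x) ⟩
    cycLen g x ∎
    where open ≡-Reasoning

  module _ {a} {A : Set a} (p : A → Bool) where

    and-map⁻ : ∀ {xs x} → Bool.and (map p xs) ≡ true → x ∈ xs → Bool.T (p x)
    and-map⁻ {xs} all-true = All.lookup (all⁺ p xs (Equivalence.from T-≡ all-true))

    and-map⁺ : ∀ xs → (∀ {x} → x ∈ xs → Bool.T (p x)) → Bool.and (map p xs) ≡ true
    and-map⁺ xs every = Equivalence.to T-≡ (all⁻ p (All.tabulate every))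

  pairsFrom : ∀ {n} → Fin n → List (Fin n × Fin n)
  pairsFrom {n} i = map (λ j → (i , j)) (filter (λ j → i <? j) (allFin n))

  ∈-pairs⁺ : ∀ {n} {i j : Fin n} → i Fin.< j → (i , j) ∈ pairs n
  ∈-pairs⁺ {n} {i} {j} i<j =
    ∈-concatMap⁺ pairsFrom (lose (∈-allFin i) (∈-map⁺ (λ j → (i , j)) (∈-filter⁺ (λ j → i <? j) (∈-allFin j) i<j)))

  ∈-pairs⁻ : ∀ {n} {i j : Fin n} → (i , j) ∈ pairs n → i Fin.< j
  ∈-pairs⁻ {n} p∈ with find (∈-concatMap⁻ pairsFrom {xs = allFin n} p∈)
  ... | i , _ , q∈ with ∈-map⁻ (λ j → (i , j)) q∈
  ...   | j , j∈ , refl = proj₂ (∈-filter⁻ (λ j → i <? j) {xs = allFin n} j∈)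

  isInjective⁻ : ∀ {n} {ω : Fin n → Fin n} → isInjective ω ≡ true → Injective _≡_ _≡_ ω
  isInjective⁻ {n} {ω} inj {i} {j} ωi≡ωj with Finₚ.<-cmp i j
  ... | tri≈ _ i≡j _ = i≡j
  ... | tri< i<j _ _ = ⊥-elim (toWitnessFalse (and-map⁻ _ inj (∈-pairs⁺ i<j)) ωi≡ωj)
  ... | tri> _ _ j<i = ⊥-elim (toWitnessFalse (and-map⁻ _ inj (∈-pairs⁺ j<i)) (sym ωi≡ωj))

  isInjective⁺ : ∀ {n} {ω : Fin n → Fin n} → Injective _≡_ _≡_ ω → isInjective ω ≡ true
  isInjective⁺ {n} {ω} inj = and-map⁺ _ (pairs n) λ { {i , j} ij∈ → fromWitnessFalse (Finₚ.<⇒≢ (∈-pairs⁻ ij∈) ∘ inj) }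

  𝟙-⌊⌋ : ∀ {p} {P : Set p} (d : Dec P) → 𝟙 (⌊ d ⌋ Bool.≟ true) ≡ 𝟙 d
  𝟙-⌊⌋ (yes _) = refl
  𝟙-⌊⌋ (no _) = refl

  count-⌊⌋ : ∀ {n p} {P : Fin n → Set p} (P? : ∀ i → Dec (P i)) → count (λ i → ⌊ P? i ⌋) (allFin n) ≡ ∑[ i < n ] 𝟙 (P? i)
  count-⌊⌋ {n} P? = trans (count≡∑ (λ i → ⌊ P? i ⌋)) (∑-cong (λ i → 𝟙-⌊⌋ (P? i)))

  cycleCount : ∀ {n} → (Fin n → Fin n) → ℕ → ℕ
  cycleCount {n} ω r = ∑[ i < n ] 𝟙 (cycLen ω i ℕ.≟ r)

  module _ {n} (a : ℕ → ℕ) {ω : Fin n → Fin n} where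

    private
      balanced : ℕ → Bool
      balanced r = ⌊ count (λ i → ⌊ cycLen ω i ℕ.≟ r ⌋) (allFin n) ℕ.≟ r * a r ⌋

    hasCycleType⁻ : hasCycleType a ω ≡ true → ∀ r → 1 ≤ r → r ≤ n → cycleCount ω r ≡ r * a r
    hasCycleType⁻ ct (suc r) _ r<n = trans (sym (count-⌊⌋ (λ i → cycLen ω i ℕ.≟ suc r)))
      (toWitness (and-map⁻ balanced ct (∈-map⁺ suc (∈-upTo⁺ r<n))))

    hasCycleType⁺ : (∀ r → 1 ≤ r → r ≤ n → cycleCount ω r ≡ r * a r) → hasCycleType a ω ≡ true
    hasCycleType⁺ counts = and-map⁺ balanced (map suc (upTo n)) balanced-at
      where
      balanced-at : ∀ {r} → r ∈ map suc (upTo n) → Bool.T (balanced r)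
      balanced-at r∈ with ∈-map⁻ suc r∈
      ... | r , r∈upTo , refl =
        fromWitness (trans (count-⌊⌋ (λ i → cycLen ω i ℕ.≟ suc r)) (counts (suc r) (s≤s z≤n) (∈-upTo⁻ r∈upTo)))

  hasCycleType-cong : ∀ {n} (a : ℕ → ℕ) {ω ω′ : Fin n → Fin n} → (∀ r → cycleCount ω r ≡ cycleCount ω′ r) →
    hasCycleType a ω ≡ hasCycleType a ω′
  hasCycleType-cong {n} a {ω} {ω′} same = cong Bool.and (map-cong balanced (map suc (upTo n)))
    where
    balanced : ∀ r → ⌊ count (λ i → ⌊ cycLen ω i ℕ.≟ r ⌋) (allFin n) ℕ.≟ r * a r ⌋ ≡ ⌊ count (λ i → ⌊ cycLen ω′ i ℕ.≟ r ⌋) (allFin n) ℕ.≟ r * a r ⌋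
    balanced r = cong (λ c → ⌊ c ℕ.≟ r * a r ⌋)
      (trans (count-⌊⌋ (λ i → cycLen ω i ℕ.≟ r)) (trans (same r) (sym (count-⌊⌋ (λ i → cycLen ω′ i ℕ.≟ r)))))

  cycleCount-conj : ∀ {n} (u v : Fin n) (ω : Fin n → Fin n) r → cycleCount (conj (transpose u v) ω) r ≡ cycleCount ω r
  cycleCount-conj {n} u v ω r = begin
    ∑[ i < n ] 𝟙 (cycLen (conj (transpose u v) ω) i ℕ.≟ r)
      ≡⟨ ∑-cong (λ i → cong (λ c → 𝟙 (c ℕ.≟ r)) (cycLen-conj u v ω i)) ⟩
    ∑[ i < n ] 𝟙 (cycLen ω (transpose u v i) ℕ.≟ r)
      ≡⟨ sym (sum-permute (λ i → 𝟙 (cycLen ω i ℕ.≟ r)) (Permutation.transpose u v)) ⟩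
    ∑[ i < n ] 𝟙 (cycLen ω i ℕ.≟ r) ∎
    where
    open ≡-Reasoning

  cycleCount-cong : ∀ {n} {ω ω′ : Fin n → Fin n} → ω ≗ ω′ → ∀ r → cycleCount ω r ≡ cycleCount ω′ r
  cycleCount-cong e r = ∑-cong (λ i → cong (λ c → 𝟙 (c ℕ.≟ r)) (cycLen-cong e i))

  firstReturn-≥3 : ∀ {n} (ω : Fin n → Fin n) x ks → (∀ {k} → k ∈ ks → 3 ≤ k) →
    firstReturn ω x ks ≡ 0 ⊎ 3 ≤ firstReturn ω x ks
  firstReturn-≥3 ω x [] _ = inj₁ refl
  firstReturn-≥3 ω x (k ∷ ks) ≥3 with iter ω k x ≟ x
  ... | yes _ = inj₂ (≥3 (here refl))
  ... | no _ = firstReturn-≥3 ω x ks (≥3 ∘ there)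

  𝟙-≟1+𝟙-≟2≡0 : ∀ {r} → r ≡ 0 ⊎ 3 ≤ r → 𝟙 (r ℕ.≟ 1) + 𝟙 (r ℕ.≟ 2) ≡ 0
  𝟙-≟1+𝟙-≟2≡0 (inj₁ refl) = refl
  𝟙-≟1+𝟙-≟2≡0 {r} (inj₂ 3≤r) = cong₂ _+_ (𝟙-no (r ℕ.≟ 1) λ { refl → ≤⇒≯ 3≤r (s≤s (s≤s z≤n)) }) (𝟙-no (r ℕ.≟ 2) λ { refl → ≤⇒≯ 3≤r (s≤s (s≤s (s≤s z≤n))) })

  module _ {m} (ω : Fin (suc (suc m)) → Fin (suc (suc m))) (x : Fin (suc (suc m))) where

    private
      -- after the candidates 1 and 2, cycLen only searches lengths 3, 4, ...
      later = map suc (applyUpTo (λ t → suc (suc t)) m)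

      later≥3 : ∀ {k} → k ∈ later → 3 ≤ k
      later≥3 k∈ with ∈-map⁻ suc k∈
      ... | _ , t∈ , refl with ∈-applyUpTo⁻ (λ t → suc (suc t)) t∈
      ...   | _ , _ , refl = s≤s (s≤s (s≤s z≤n))

      beyond = firstReturn-≥3 ω x later later≥3

    𝟙-cycLen≟1 : 𝟙 (cycLen ω x ℕ.≟ 1) ≡ 𝟙 (ω x ≟ x)
    𝟙-cycLen≟1 rewrite cycLen≡firstReturn ω x with ω x ≟ x
    ... | yes _ = refl
    ... | no _ with ω (ω x) ≟ x
    ...   | yes _ = refl
    ...   | no _ = m+n≡0⇒m≡0 _ (𝟙-≟1+𝟙-≟2≡0 beyond)

    𝟙-cycLen≟1+𝟙-cycLen≟2 : 𝟙 (cycLen ω x ℕ.≟ 1) + 𝟙 (cycLen ω x ℕ.≟ 2) ≡ 𝟙 (ω (ω x) ≟ x)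
    𝟙-cycLen≟1+𝟙-cycLen≟2 rewrite cycLen≡firstReturn ω x with ω x ≟ x
    ... | yes ωx≡x = sym (𝟙-yes (ω (ω x) ≟ x) (trans (cong ω ωx≡x) ωx≡x))
    ... | no _ with ω (ω x) ≟ x
    ...   | yes _ = refl
    ...   | no _ = 𝟙-≟1+𝟙-≟2≡0 beyond

  module _ {m} (a : ℕ → ℕ) {ω : Fin (suc (suc m)) → Fin (suc (suc m))} (ct : hasCycleType a ω ≡ true) where

    private n = suc (suc m)

    ∑-fixedPoints : ∑[ x < n ] 𝟙 (ω x ≟ x) ≡ a 1
    ∑-fixedPoints = begin
      ∑[ x < n ] 𝟙 (ω x ≟ x) ≡⟨ ∑-cong (λ x → sym (𝟙-cycLen≟1 ω x)) ⟩
      cycleCount ω 1 ≡⟨ hasCycleType⁻ a {ω} ct 1 (s≤s z≤n) (s≤s z≤n) ⟩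
      1 * a 1 ≡⟨ *-identityˡ (a 1) ⟩
      a 1 ∎
      where open ≡-Reasoning

    ∑-squareFixedPoints : ∑[ x < n ] 𝟙 (ω (ω x) ≟ x) ≡ a 1 + 2 * a 2
    ∑-squareFixedPoints = begin
      ∑[ x < n ] 𝟙 (ω (ω x) ≟ x) ≡⟨ ∑-cong (λ x → sym (𝟙-cycLen≟1+𝟙-cycLen≟2 ω x)) ⟩
      ∑[ x < n ] (𝟙 (cycLen ω x ℕ.≟ 1) + 𝟙 (cycLen ω x ℕ.≟ 2)) ≡⟨ ∑-distrib-+ (λ x → 𝟙 (cycLen ω x ℕ.≟ 1)) (λ x → 𝟙 (cycLen ω x ℕ.≟ 2)) ⟩
      cycleCount ω 1 + cycleCount ω 2 ≡⟨ cong₂ _+_ (hasCycleType⁻ a {ω} ct 1 (s≤s z≤n) (s≤s z≤n)) (hasCycleType⁻ a {ω} ct 2 (s≤s z≤n) (s≤s (s≤s z≤n))) ⟩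
      1 * a 1 + 2 * a 2 ≡⟨ cong (_+ 2 * a 2) (*-identityˡ (a 1)) ⟩
      a 1 + 2 * a 2 ∎
      where open ≡-Reasoning

  -- A permutation of every cycle type

  module _ {N} (f : Fin N → Fin N) where

    iter-+ : ∀ j k x → iter f (j + k) x ≡ iter f j (iter f k x)
    iter-+ zero k x = refl
    iter-+ (suc j) k x = cong f (iter-+ j k x)

    iter-suc : ∀ k x → iter f (suc k) x ≡ iter f k (f x)
    iter-suc k x = trans (cong (λ t → iter f t x) (+-comm 1 k)) (iter-+ k 1 x)

    LeastPeriod : Fin N → ℕ → Set
    LeastPeriod x p = 1 ≤ p × iter f p x ≡ x × (∀ k → 1 ≤ k → k < p → iter f k x ≢ x)

    private
      firstReturn-from : ∀ {x p} → LeastPeriod x p → ∀ (g : ℕ → ℕ) b K → (∀ t → g t ≡ t + suc b) → b < p → p ≤ b + K →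
        firstReturn f x (applyUpTo g K) ≡ p
      firstReturn-from {x} {p} lp g b zero g≡ b<p p≤b+0 = ⊥-elim (<⇒≱ b<p (subst (p ≤_) (+-identityʳ b) p≤b+0))
      firstReturn-from {x} {p} lp@(_ , returns , least) g b (suc K) g≡ b<p p≤b+K with iter f (g 0) x ≟ x
      ... | yes hit = ≤-antisym (subst (_≤ p) (sym (g≡ 0)) b<p) (≮⇒≥ λ g0<p → least (g 0) (subst (1 ≤_) (sym (g≡ 0)) (s≤s z≤n)) g0<p hit)
      ... | no miss = firstReturn-from lp (g ∘ suc) (suc b) K (λ t → trans (g≡ (suc t)) (sym (+-suc t (suc b))))
        (≤∧≢⇒< b<p λ sb≡p → miss (subst (λ k → iter f k x ≡ x) (sym (trans (g≡ 0) sb≡p)) returns))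
        (subst (p ≤_) (+-suc b K) p≤b+K)

    cycLen-leastPeriod : ∀ {x p} → p ≤ N → LeastPeriod x p → cycLen f x ≡ p
    cycLen-leastPeriod {x} {p} p≤N lp@(1≤p , _ , _) = trans (cycLen≡firstReturn f x)
      (trans (cong (firstReturn f x) (map-upTo suc N)) (firstReturn-from lp suc 0 N (+-comm 1) 1≤p p≤N))

    periodic⇒injective : (period : Fin N → ℕ) → (∀ x → 1 ≤ period x) → (∀ x → iter f (period x) x ≡ x) →
      Injective _≡_ _≡_ f
    periodic⇒injective period ≥1 returns {x} {y} fx≡fy = begin
      x                                     ≡⟨ sym (returns x) ⟩
      iter f (period x) x                   ≡⟨ shift x y fx≡fy (period x) (≥1 x) ⟩
      iter f (period x) y                   ≡⟨ cong (iter f (period x)) (sym (returns y)) ⟩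
      iter f (period x) (iter f (period y) y) ≡⟨ sym (iter-+ (period x) (period y) y) ⟩
      iter f (period x + period y) y        ≡⟨ cong (λ t → iter f t y) (+-comm (period x) (period y)) ⟩
      iter f (period y + period x) y        ≡⟨ iter-+ (period y) (period x) y ⟩
      iter f (period y) (iter f (period x) y) ≡⟨ cong (iter f (period y)) (sym (shift x y fx≡fy (period x) (≥1 x))) ⟩
      iter f (period y) (iter f (period x) x) ≡⟨ cong (iter f (period y)) (returns x) ⟩
      iter f (period y) x                   ≡⟨ sym (shift y x (sym fx≡fy) (period y) (≥1 y)) ⟩
      iter f (period y) y                   ≡⟨ returns y ⟩
      y                                     ∎
      where
      open ≡-Reasoning
      shift : ∀ x y → f x ≡ f y → ∀ k → 1 ≤ k → iter f k x ≡ iter f k y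
      shift x y e (suc k) _ = trans (iter-suc k x) (trans (cong (iter f k) e) (sym (iter-suc k y)))

  rotation : (r : ℕ) → Fin (suc r) → Fin (suc r)
  rotation r u = Fin.fromℕ< (m%n<n (suc (toℕ u)) (suc r))

  toℕ-iter-rotation : ∀ r k (u : Fin (suc r)) → toℕ (iter (rotation r) k u) ≡ (toℕ u + k) % suc r
  toℕ-iter-rotation r zero u = sym (trans (cong (_% suc r) (+-identityʳ (toℕ u))) (m<n⇒m%n≡m (Finₚ.toℕ<n u)))
  toℕ-iter-rotation r (suc k) u = begin
    toℕ (rotation r (iter (rotation r) k u))    ≡⟨ Finₚ.toℕ-fromℕ< _ ⟩
    suc (toℕ (iter (rotation r) k u)) % suc r   ≡⟨ cong (λ t → suc t % suc r) (toℕ-iter-rotation r k u) ⟩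
    (1 + (toℕ u + k) % suc r) % suc r           ≡⟨ cong (_% suc r) (+-comm 1 ((toℕ u + k) % suc r)) ⟩
    ((toℕ u + k) % suc r + 1) % suc r           ≡⟨ %-distribˡ-+ ((toℕ u + k) % suc r) 1 (suc r) ⟩
    ((toℕ u + k) % suc r % suc r + 1 % suc r) % suc r ≡⟨ cong (λ t → (t + 1 % suc r) % suc r) (m%n%n≡m%n (toℕ u + k) (suc r)) ⟩
    ((toℕ u + k) % suc r + 1 % suc r) % suc r   ≡⟨ sym (%-distribˡ-+ (toℕ u + k) 1 (suc r)) ⟩
    (toℕ u + k + 1) % suc r                     ≡⟨ cong (_% suc r) (trans (+-assoc (toℕ u) k 1) (cong (toℕ u +_) (+-comm k 1))) ⟩
    (toℕ u + suc k) % suc r                     ∎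
    where open ≡-Reasoning

  leastPeriod-rotation : ∀ r (u : Fin (suc r)) → LeastPeriod (rotation r) u (suc r)
  leastPeriod-rotation r u = s≤s z≤n , returns , least
    where
    t = toℕ u
    d = suc r
    returns : iter (rotation r) d u ≡ u
    returns = Finₚ.toℕ-injective (trans (toℕ-iter-rotation r d u) (trans ([m+n]%n≡m%n t d) (m<n⇒m%n≡m (Finₚ.toℕ<n u))))
    least : ∀ k → 1 ≤ k → k < d → iter (rotation r) k u ≢ u
    least k 1≤k k<d back = by-cases (t + k ℕ.<? d)
      where
      wraps : (t + k) % d ≡ t
      wraps = trans (sym (toℕ-iter-rotation r k u)) (cong toℕ back)
      by-cases : Dec (t + k < d) → ⊥
      by-cases (yes t+k<d) = <⇒≱ 1≤k (≤-reflexive (+-cancelˡ-≡ t k 0 (trans (trans (sym (m<n⇒m%n≡m t+k<d)) wraps) (sym (+-identityʳ t)))))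
      by-cases (no t+k≮d) = <⇒≢ k<d (+-cancelˡ-≡ t k d (trans (sym (m∸n+n≡m d≤t+k)) (cong (_+ d) t+k∸d≡t)))
        where
        d≤t+k : d ≤ t + k
        d≤t+k = ≮⇒≥ t+k≮d
        t+k∸d<d : t + k ∸ d < d
        t+k∸d<d = +-cancelʳ-< d (t + k ∸ d) d (subst (_< d + d) (sym (m∸n+n≡m d≤t+k)) (+-mono-< (Finₚ.toℕ<n u) k<d))
        t+k∸d≡t : t + k ∸ d ≡ t
        t+k∸d≡t = trans (sym (m<n⇒m%n≡m t+k∸d<d)) (trans (m≤n⇒[n∸m]%m≡n%m d≤t+k) wraps)

  -- The permutation with one cycle of length suc r for each r ∈ rs, cycles laid out in consecutive blocks.
  blocksSize : List ℕ → ℕ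
  blocksSize [] = 0
  blocksSize (r ∷ rs) = suc r + blocksSize rs

  blocks : (rs : List ℕ) → Fin (blocksSize rs) → Fin (blocksSize rs)
  blocks [] = λ x → x
  blocks (r ∷ rs) = join (suc r) (blocksSize rs) ∘ Sum.map (rotation r) (blocks rs) ∘ splitAt (suc r)

  blockLength : (rs : List ℕ) → Fin (blocksSize rs) → ℕ
  blockLength [] _ = 0
  blockLength (r ∷ rs) = [ (λ _ → suc r) , blockLength rs ]′ ∘ splitAt (suc r)

  splitAt-view : ∀ m {n} (x : Fin (m + n)) → (∃ λ u → x ≡ u ↑ˡ n) ⊎ (∃ λ v → x ≡ m ↑ʳ v)
  splitAt-view m {n} x with splitAt m x in eq
  ... | inj₁ u = inj₁ (u , sym (Finₚ.splitAt⁻¹-↑ˡ eq))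
  ... | inj₂ v = inj₂ (v , sym (Finₚ.splitAt⁻¹-↑ʳ eq))

  module _ (r : ℕ) (rs : List ℕ) where

    private
      n = blocksSize rs

    blocks-↑ˡ : ∀ u → blocks (r ∷ rs) (u ↑ˡ n) ≡ rotation r u ↑ˡ n
    blocks-↑ˡ u = cong (join (suc r) n ∘ Sum.map (rotation r) (blocks rs)) (Finₚ.splitAt-↑ˡ (suc r) u n)

    blocks-↑ʳ : ∀ v → blocks (r ∷ rs) (suc r ↑ʳ v) ≡ suc r ↑ʳ blocks rs v
    blocks-↑ʳ v = cong (join (suc r) n ∘ Sum.map (rotation r) (blocks rs)) (Finₚ.splitAt-↑ʳ (suc r) n v)

    blockLength-↑ˡ : ∀ u → blockLength (r ∷ rs) (u ↑ˡ n) ≡ suc r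
    blockLength-↑ˡ u = cong [ (λ _ → suc r) , blockLength rs ]′ (Finₚ.splitAt-↑ˡ (suc r) u n)

    blockLength-↑ʳ : ∀ v → blockLength (r ∷ rs) (suc r ↑ʳ v) ≡ blockLength rs v
    blockLength-↑ʳ v = cong [ (λ _ → suc r) , blockLength rs ]′ (Finₚ.splitAt-↑ʳ (suc r) n v)

    iter-blocks-↑ˡ : ∀ k u → iter (blocks (r ∷ rs)) k (u ↑ˡ n) ≡ iter (rotation r) k u ↑ˡ n
    iter-blocks-↑ˡ zero u = refl
    iter-blocks-↑ˡ (suc k) u = trans (cong (blocks (r ∷ rs)) (iter-blocks-↑ˡ k u)) (blocks-↑ˡ _)

    iter-blocks-↑ʳ : ∀ k v → iter (blocks (r ∷ rs)) k (suc r ↑ʳ v) ≡ suc r ↑ʳ iter (blocks rs) k v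
    iter-blocks-↑ʳ zero v = refl
    iter-blocks-↑ʳ (suc k) v = trans (cong (blocks (r ∷ rs)) (iter-blocks-↑ʳ k v)) (blocks-↑ʳ _)

  leastPeriod-blocks : ∀ rs x → blockLength rs x ≤ blocksSize rs × LeastPeriod (blocks rs) x (blockLength rs x)
  leastPeriod-blocks (r ∷ rs) x with splitAt-view (suc r) x
  ... | inj₁ (u , refl) with leastPeriod-rotation r u
  ...   | 1≤p , returns , least rewrite blockLength-↑ˡ r rs u =
    m≤m+n (suc r) (blocksSize rs) , 1≤p ,
    trans (iter-blocks-↑ˡ r rs (suc r) u) (cong (_↑ˡ blocksSize rs) returns) ,
    λ k 1≤k k<p back → least k 1≤k k<p (Finₚ.↑ˡ-injective (blocksSize rs) _ _ (trans (sym (iter-blocks-↑ˡ r rs k u)) back))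
  leastPeriod-blocks (r ∷ rs) x | inj₂ (v , refl) with leastPeriod-blocks rs v
  ...   | p≤n , 1≤p , returns , least rewrite blockLength-↑ʳ r rs v =
    ≤-trans p≤n (m≤n+m (blocksSize rs) (suc r)) , 1≤p ,
    trans (iter-blocks-↑ʳ r rs (blockLength rs v) v) (cong (suc r ↑ʳ_) returns) ,
    λ k 1≤k k<p back → least k 1≤k k<p (Finₚ.↑ʳ-injective (suc r) _ _ (trans (sym (iter-blocks-↑ʳ r rs k v)) back))

  cycLen-blocks : ∀ rs x → cycLen (blocks rs) x ≡ blockLength rs x
  cycLen-blocks rs x = cycLen-leastPeriod (blocks rs) (proj₁ (leastPeriod-blocks rs x)) (proj₂ (leastPeriod-blocks rs x))

  blocks-injective : ∀ rs → Injective _≡_ _≡_ (blocks rs)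
  blocks-injective rs = periodic⇒injective (blocks rs) (blockLength rs)
    (λ x → proj₁ (proj₂ (leastPeriod-blocks rs x))) (λ x → proj₁ (proj₂ (proj₂ (leastPeriod-blocks rs x))))

  ∑-↑ : ∀ m n (h : Fin (m + n) → ℕ) → ∑[ x < m + n ] h x ≡ ∑[ u < m ] h (u ↑ˡ n) + ∑[ v < n ] h (m ↑ʳ v)
  ∑-↑ zero n h = refl
  ∑-↑ (suc m) n h = trans (cong (h Fin.zero +_) (∑-↑ m n (h ∘ Fin.suc))) (sym (+-assoc (h Fin.zero) _ _))

  multiplicity : ℕ → List ℕ → ℕ
  multiplicity s rs = ∑ˡ rs (λ r → 𝟙 (suc r ℕ.≟ s))

  ∑-blockLength : ∀ rs s → ∑[ x < blocksSize rs ] 𝟙 (blockLength rs x ℕ.≟ s) ≡ s * multiplicity s rs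
  ∑-blockLength [] s = sym (*-zeroʳ s)
  ∑-blockLength (r ∷ rs) s = begin
    ∑[ x < blocksSize (r ∷ rs) ] 𝟙 (blockLength (r ∷ rs) x ℕ.≟ s)
      ≡⟨ ∑-↑ (suc r) (blocksSize rs) (λ x → 𝟙 (blockLength (r ∷ rs) x ℕ.≟ s)) ⟩
    ∑[ u < suc r ] 𝟙 (blockLength (r ∷ rs) (u ↑ˡ _) ℕ.≟ s) + ∑[ v < blocksSize rs ] 𝟙 (blockLength (r ∷ rs) (suc r ↑ʳ v) ℕ.≟ s)
      ≡⟨ cong₂ _+_ (∑-cong (λ u → cong (λ ℓ → 𝟙 (ℓ ℕ.≟ s)) (blockLength-↑ˡ r rs u)))
                   (∑-cong (λ v → cong (λ ℓ → 𝟙 (ℓ ℕ.≟ s)) (blockLength-↑ʳ r rs v))) ⟩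
    ∑[ u < suc r ] 𝟙 (suc r ℕ.≟ s) + ∑[ v < blocksSize rs ] 𝟙 (blockLength rs v ℕ.≟ s)
      ≡⟨ cong₂ _+_ (∑-const (suc r) (𝟙 (suc r ℕ.≟ s))) (∑-blockLength rs s) ⟩
    suc r * 𝟙 (suc r ℕ.≟ s) + s * multiplicity s rs
      ≡⟨ cong (_+ s * multiplicity s rs) (size≡s (suc r ℕ.≟ s)) ⟩
    s * 𝟙 (suc r ℕ.≟ s) + s * multiplicity s rs
      ≡⟨ sym (*-distribˡ-+ s (𝟙 (suc r ℕ.≟ s)) (multiplicity s rs)) ⟩
    s * multiplicity s (r ∷ rs) ∎
    where
    open ≡-Reasoning
    size≡s : (d : Dec (suc r ≡ s)) → suc r * 𝟙 d ≡ s * 𝟙 d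
    size≡s (yes refl) = refl
    size≡s (no _) = trans (*-zeroʳ (suc r)) (sym (*-zeroʳ s))

  ∑ˡ-applyUpTo : ∀ (h : ℕ → ℕ) n (g : ℕ → ℕ) → ∑ˡ (applyUpTo h n) g ≡ ∑[ k < n ] g (h (toℕ k))
  ∑ˡ-applyUpTo h zero g = refl
  ∑ˡ-applyUpTo h (suc n) g = cong (g (h 0) +_) (∑ˡ-applyUpTo (h ∘ suc) n g)

  ∑ˡ-replicate : ∀ k (r : ℕ) (g : ℕ → ℕ) → ∑ˡ (replicate k r) g ≡ k * g r
  ∑ˡ-replicate zero r g = refl
  ∑ˡ-replicate (suc k) r g = cong (g r +_) (∑ˡ-replicate k r g)

  blocksSize≡∑ˡ : ∀ rs → blocksSize rs ≡ ∑ˡ rs suc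
  blocksSize≡∑ˡ [] = refl
  blocksSize≡∑ˡ (r ∷ rs) = cong (suc r +_) (blocksSize≡∑ˡ rs)

  -- the cycle lengths of (1^{a 1}, ..., n^{a n}), each lowered by one as in blocks
  cycleLengths : (ℕ → ℕ) → ℕ → List ℕ
  cycleLengths a n = concatMap (λ s → replicate (a (suc s)) s) (upTo n)

  blocksSize-cycleLengths : ∀ a n → IsPartitionOf a n → blocksSize (cycleLengths a n) ≡ n
  blocksSize-cycleLengths a n partition = begin
    blocksSize (cycleLengths a n)
      ≡⟨ blocksSize≡∑ˡ (cycleLengths a n) ⟩
    ∑ˡ (cycleLengths a n) suc
      ≡⟨ ∑ˡ-concatMap (λ s → replicate (a (suc s)) s) (upTo n) suc ⟩
    ∑ˡ (upTo n) (λ s → ∑ˡ (replicate (a (suc s)) s) suc)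
      ≡⟨ ∑ˡ-cong (upTo n) (λ s → trans (∑ˡ-replicate (a (suc s)) s suc) (*-comm (a (suc s)) (suc s))) ⟩
    ∑ˡ (upTo n) (λ s → suc s * a (suc s))
      ≡⟨ sym (∑ˡ-map suc (upTo n) (λ r → r * a r)) ⟩
    ∑ˡ (map suc (upTo n)) (λ r → r * a r)
      ≡⟨ partition ⟩
    n ∎
    where open ≡-Reasoning

  multiplicity-cycleLengths : ∀ a n t → 1 ≤ t → t ≤ n → multiplicity t (cycleLengths a n) ≡ a t
  multiplicity-cycleLengths a n (suc t) _ t<n = begin
    multiplicity (suc t) (cycleLengths a n)
      ≡⟨ ∑ˡ-concatMap (λ s → replicate (a (suc s)) s) (upTo n) (λ r → 𝟙 (suc r ℕ.≟ suc t)) ⟩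
    ∑ˡ (upTo n) (λ s → ∑ˡ (replicate (a (suc s)) s) (λ r → 𝟙 (suc r ℕ.≟ suc t)))
      ≡⟨ ∑ˡ-cong (upTo n) (λ s → trans (∑ˡ-replicate (a (suc s)) s (λ r → 𝟙 (suc r ℕ.≟ suc t))) (*-comm (a (suc s)) _)) ⟩
    ∑ˡ (upTo n) (λ s → 𝟙 (suc s ℕ.≟ suc t) * a (suc s))
      ≡⟨ ∑ˡ-applyUpTo (λ s → s) n (λ s → 𝟙 (suc s ℕ.≟ suc t) * a (suc s)) ⟩
    ∑[ k < n ] (𝟙 (suc (toℕ k) ℕ.≟ suc t) * a (suc (toℕ k)))
      ≡⟨ ∑-cong (λ k → cong (_* a (suc (toℕ k))) (𝟙-cong (suc (toℕ k) ℕ.≟ suc t) (k ≟ t′) to from)) ⟩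
    ∑[ k < n ] (𝟙 (k ≟ t′) * a (suc (toℕ k)))
      ≡⟨ ∑-𝟙-≟ t′ (λ k → a (suc (toℕ k))) ⟩
    a (suc (toℕ t′))
      ≡⟨ cong (a ∘ suc) (Finₚ.toℕ-fromℕ< t<n) ⟩
    a (suc t) ∎
    where
    open ≡-Reasoning
    t′ = Fin.fromℕ< t<n
    to : ∀ {k} → suc (toℕ k) ≡ suc t → k ≡ t′
    to e = Finₚ.toℕ-injective (trans (suc-injective e) (sym (Finₚ.toℕ-fromℕ< t<n)))
    from : ∀ {k} → k ≡ t′ → suc (toℕ k) ≡ suc t
    from refl = cong suc (Finₚ.toℕ-fromℕ< t<n)

  hasCycleType-blocks : ∀ (a : ℕ → ℕ) rs → (∀ t → 1 ≤ t → t ≤ blocksSize rs → multiplicity t rs ≡ a t) →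
    hasCycleType a (blocks rs) ≡ true
  hasCycleType-blocks a rs mult = hasCycleType⁺ a {blocks rs} λ r 1≤r r≤n → begin
    cycleCount (blocks rs) r ≡⟨ ∑-cong (λ x → cong (λ ℓ → 𝟙 (ℓ ℕ.≟ r)) (cycLen-blocks rs x)) ⟩
    ∑[ x < blocksSize rs ] 𝟙 (blockLength rs x ℕ.≟ r) ≡⟨ ∑-blockLength rs r ⟩
    r * multiplicity r rs ≡⟨ cong (r *_) (mult r 1≤r r≤n) ⟩
    r * a r ∎
    where open ≡-Reasoning

  permutationOfType : ∀ n (a : ℕ → ℕ) → IsPartitionOf a n →
    Σ (Fin n → Fin n) λ ω → isInjective ω ≡ true × hasCycleType a ω ≡ true
  permutationOfType n a partition = subst (λ N → Σ (Fin N → Fin N) λ ω → isInjective ω ≡ true × hasCycleType a ω ≡ true) size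
    (blocks rs , isInjective⁺ {ω = blocks rs} (blocks-injective rs) ,
     hasCycleType-blocks a rs λ t 1≤t t≤ → multiplicity-cycleLengths a n t 1≤t (subst (t ≤_) size t≤))
    where
    rs = cycleLengths a n
    size = blocksSize-cycleLengths a n partition

  module _ {n} (u v : Fin n) where

    private
      τ = transpose u v
      τ-invol = transpose-involutive u v

    conj-conj : (ω : Fin n → Fin n) → conj τ (conj τ ω) ≗ ω
    conj-conj ω x = trans (τ-invol _) (cong ω (τ-invol x))

    conj-injective : {ω : Fin n → Fin n} → Injective _≡_ _≡_ ω → Injective _≡_ _≡_ (conj τ ω)
    conj-injective inj {x} {y} e = trans (sym (τ-invol x)) (trans (cong τ (inj (trans (sym (τ-invol _)) (trans (cong τ e) (τ-invol _))))) (τ-invol y))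

    isInjective-conj⁺ : (ω : Fin n → Fin n) → isInjective ω ≡ true → isInjective (conj τ ω) ≡ true
    isInjective-conj⁺ ω inj = isInjective⁺ {ω = conj τ ω} (conj-injective (isInjective⁻ {ω = ω} inj))

    isInjective-conj⁻ : (ω : Fin n → Fin n) → isInjective (conj τ ω) ≡ true → isInjective ω ≡ true
    isInjective-conj⁻ ω inj = isInjective⁺ {ω = ω} λ {x} {y} e →
      conj-injective {conj τ ω} (isInjective⁻ {ω = conj τ ω} inj) (trans (conj-conj ω x) (trans e (sym (conj-conj ω y))))

  isInjective-cong : ∀ {n} {ω ω′ : Fin n → Fin n} → ω ≗ ω′ → isInjective ω ≡ true → isInjective ω′ ≡ true
  isInjective-cong {ω = ω} {ω′} e inj = isInjective⁺ {ω = ω′} λ {x} {y} e′ → isInjective⁻ {ω = ω} inj (trans (e x) (trans e′ (sym (e y))))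

  module Class (n : ℕ) (a : ℕ → ℕ) where

    InClass : (Fin n → Fin n) → Set
    InClass ω = isInjective ω ≡ true × hasCycleType a ω ≡ true

    Σᶜ : ((Fin n → Fin n) → ℕ) → ℕ
    Σᶜ G = ∑ˡ (ConjClass n a) G

    ∈-ConjClass⁻ : ∀ {ω} → ω ∈ ConjClass n a → InClass ω
    ∈-ConjClass⁻ ω∈ with ∈-filter⁻ (λ ω → hasCycleType a ω Bool.≟ true) {xs = Sym n} ω∈
    ... | ω∈Sym , ct = proj₂ (∈-filter⁻ (λ ω → isInjective ω Bool.≟ true) {xs = allFuns n n} ω∈Sym) , ct

    Σᶜ-cong : {G H : (Fin n → Fin n) → ℕ} → (∀ ω → InClass ω → G ω ≡ H ω) → Σᶜ G ≡ Σᶜ H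
    Σᶜ-cong e = ∑ˡ-cong-∈ (ConjClass n a) λ {ω} ω∈ → e ω (∈-ConjClass⁻ ω∈)

    Σᶜ-*ˡ : (k : ℕ) (G : (Fin n → Fin n) → ℕ) → Σᶜ (λ ω → k * G ω) ≡ k * Σᶜ G
    Σᶜ-*ˡ k G = ∑ˡ-*ˡ (ConjClass n a) k G

    Σᶜ-∑ : (g : (Fin n → Fin n) → Fin n → ℕ) → Σᶜ (λ ω → ∑[ x < n ] g ω x) ≡ ∑[ x < n ] Σᶜ (λ ω → g ω x)
    Σᶜ-∑ g = ∑ˡ-∑ (ConjClass n a) g

    private
      inClass? : (ω : Fin n → Fin n) → ℕ
      inClass? ω = 𝟙 (isInjective ω Bool.≟ true) * 𝟙 (hasCycleType a ω Bool.≟ true)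

      Σᶜ≡∑ˡ-allFuns : (G : (Fin n → Fin n) → ℕ) → Σᶜ G ≡ ∑ˡ (allFuns n n) (λ ω → inClass? ω * G ω)
      Σᶜ≡∑ˡ-allFuns G = begin
        ∑ˡ (ConjClass n a) G
          ≡⟨ ∑ˡ-filter (λ ω → hasCycleType a ω Bool.≟ true) (Sym n) G ⟩
        ∑ˡ (Sym n) (λ ω → 𝟙 (hasCycleType a ω Bool.≟ true) * G ω)
          ≡⟨ ∑ˡ-filter (λ ω → isInjective ω Bool.≟ true) (allFuns n n) _ ⟩
        ∑ˡ (allFuns n n) (λ ω → 𝟙 (isInjective ω Bool.≟ true) * (𝟙 (hasCycleType a ω Bool.≟ true) * G ω))
          ≡⟨ ∑ˡ-cong (allFuns n n) (λ ω → sym (*-assoc (𝟙 (isInjective ω Bool.≟ true)) (𝟙 (hasCycleType a ω Bool.≟ true)) (G ω))) ⟩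
        ∑ˡ (allFuns n n) (λ ω → inClass? ω * G ω) ∎
        where open ≡-Reasoning

      inClass?-cong : Respects≗ inClass?
      inClass?-cong {ω} {ω′} e = cong₂ _*_
        (𝟙-cong (isInjective ω Bool.≟ true) (isInjective ω′ Bool.≟ true) (isInjective-cong {ω = ω} {ω′} e) (isInjective-cong {ω = ω′} {ω} (sym ∘ e)))
        (cong (λ b → 𝟙 (b Bool.≟ true)) (hasCycleType-cong a {ω} {ω′} (cycleCount-cong {ω = ω} {ω′} e)))

      inClass?-conj : ∀ u v ω → inClass? (conj (transpose u v) ω) ≡ inClass? ω
      inClass?-conj u v ω = cong₂ _*_
        (𝟙-cong (isInjective (conj (transpose u v) ω) Bool.≟ true) (isInjective ω Bool.≟ true) (isInjective-conj⁻ u v ω) (isInjective-conj⁺ u v ω))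
        (cong (λ b → 𝟙 (b Bool.≟ true)) (hasCycleType-cong a {conj (transpose u v) ω} {ω} (cycleCount-conj u v ω)))

    Σᶜ-conj : (u v : Fin n) (G : (Fin n → Fin n) → ℕ) → Respects≗ G → Σᶜ (λ ω → G (conj (transpose u v) ω)) ≡ Σᶜ G
    Σᶜ-conj u v G resp = begin
      Σᶜ (G ∘ τ∙)
        ≡⟨ Σᶜ≡∑ˡ-allFuns (G ∘ τ∙) ⟩
      ∑ˡ (allFuns n n) (λ ω → inClass? ω * G (τ∙ ω))
        ≡⟨ ∑ˡ-cong (allFuns n n) (λ ω → cong (_* G (τ∙ ω)) (sym (inClass?-conj u v ω))) ⟩
      ∑ˡ (allFuns n n) (λ ω → inClass? (τ∙ ω) * G (τ∙ ω))
        ≡⟨ ∑-allFuns-involution τ∙ (λ e x → cong (transpose u v) (e _)) (conj-conj u v) (λ ω → inClass? ω * G ω) (λ e → cong₂ _*_ (inClass?-cong e) (resp e)) ⟩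
      ∑ˡ (allFuns n n) (λ ω → inClass? ω * G ω)
        ≡⟨ sym (Σᶜ≡∑ˡ-allFuns G) ⟩
      Σᶜ G ∎
      where
      open ≡-Reasoning
      τ∙ = conj (transpose u v)

    Σᶜ-1-positive : ∀ {ω₀} → InClass ω₀ → 1 ≤ Σᶜ (λ _ → 1)
    Σᶜ-1-positive {ω₀} (inj , ct) = begin
      1 ≡⟨ sym (cong₂ (λ b c → 𝟙 (b Bool.≟ true) * 𝟙 (c Bool.≟ true) * 1) inj ct) ⟩
      inClass? ω₀ * 1 ≤⟨ ∑-allFuns-≥ (λ ω → inClass? ω * 1) (λ e → cong (_* 1) (inClass?-cong e)) ω₀ ⟩
      ∑ˡ (allFuns n n) (λ ω → inClass? ω * 1) ≡⟨ sym (Σᶜ≡∑ˡ-allFuns (λ _ → 1)) ⟩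
      Σᶜ (λ _ → 1) ∎
      where open ≤-Reasoning

  -- Matrices with a pattern around two indices

  below : ∀ {n} → (Fin n → Fin n → ℕ) → ℕ
  below {n} G = ∑[ k < n ] ∑[ l < n ] (𝟙 (l <? k) * G k l)

  total : ∀ {n} → (Fin n → Fin n → ℕ) → ℕ
  total {n} G = ∑[ k < n ] ∑[ l < n ] G k l

  module _ {n} {i j : Fin n} (i<j : i Fin.< j) where

    private
      i≢j = Finₚ.<⇒≢ i<j
      out : Fin n → ℕ
      out l = 𝟙 (outside? i j l)

    record Pattern (G : Fin n → Fin n → ℕ) (P Q : ℕ) : Set where
      field
        diagonal : ∀ k → G k k ≡ 0
        row-i : ∀ l → Outside i j l → G i l ≡ P
        column-j : ∀ k → Outside i j k → G k j ≡ P
        row-j : ∀ l → Outside i j l → G j l ≡ Q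
        column-i : ∀ k → Outside i j k → G k i ≡ Q
        symmetric : ∀ k l → Outside i j k → Outside i j l → G k l ≡ G l k

    Pattern-flip : ∀ {G P Q} → Pattern G P Q → Pattern (flip G) Q P
    Pattern-flip p = record
      { diagonal = diagonal ; row-i = column-i ; column-j = row-j ; row-j = column-j ; column-i = row-i
      ; symmetric = λ k l ok ol → symmetric l k ol ok }
      where open Pattern p

    outsideBelow outsideAbove : Fin n → ℕ
    outsideBelow x = ∑[ l < n ] (out l * 𝟙 (l <? x))
    outsideAbove x = ∑[ l < n ] (out l * 𝟙 (x <? l))

    belowOutside : (Fin n → Fin n → ℕ) → ℕ
    belowOutside G = ∑[ k < n ] (out k * ∑[ l < n ] (out l * (𝟙 (l <? k) * G k l)))

    below-decomposition : ∀ {G P Q} → Pattern G P Q →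
      below G ≡ outsideBelow i * P + (G j i + outsideBelow j * Q) + (outsideAbove i * Q + outsideAbove j * P + belowOutside G)
    below-decomposition {G} {P} {Q} shape = begin
      ∑[ k < n ] row k
        ≡⟨ ∑-split₂ i≢j row ⟩
      row i + row j + ∑[ k < n ] (out k * row k)
        ≡⟨ cong₂ (λ x y → x + y + ∑[ k < n ] (out k * row k)) row-i-sum row-j-sum ⟩
      outsideBelow i * P + (G j i + outsideBelow j * Q) + ∑[ k < n ] (out k * row k)
        ≡⟨ cong (outsideBelow i * P + (G j i + outsideBelow j * Q) +_) rows-outside ⟩
      outsideBelow i * P + (G j i + outsideBelow j * Q) + (outsideAbove i * Q + outsideAbove j * P + belowOutside G) ∎
      where
      open ≡-Reasoning
      open Pattern shape
      row : Fin n → ℕ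
      row k = ∑[ l < n ] (𝟙 (l <? k) * G k l)
      inner : Fin n → ℕ
      inner k = ∑[ l < n ] (out l * (𝟙 (l <? k) * G k l))
      j≮i = λ j<i → <-asym i<j j<i
      row-i-sum : row i ≡ outsideBelow i * P
      row-i-sum = begin
        row i ≡⟨ ∑-split₂ i≢j (λ l → 𝟙 (l <? i) * G i l) ⟩
        𝟙 (i <? i) * G i i + 𝟙 (j <? i) * G i j + inner i
          ≡⟨ cong₂ (λ x y → x * G i i + y * G i j + inner i) (𝟙-no (i <? i) (<-irrefl refl)) (𝟙-no (j <? i) j≮i) ⟩
        inner i ≡⟨ ∑-outside-const (λ l → 𝟙 (l <? i)) (G i) P row-i ⟩
        outsideBelow i * P ∎
      row-j-sum : row j ≡ G j i + outsideBelow j * Q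
      row-j-sum = begin
        row j ≡⟨ ∑-split₂ i≢j (λ l → 𝟙 (l <? j) * G j l) ⟩
        𝟙 (i <? j) * G j i + 𝟙 (j <? j) * G j j + inner j
          ≡⟨ cong₂ (λ x y → x * G j i + y * G j j + inner j) (𝟙-yes (i <? j) i<j) (𝟙-no (j <? j) (<-irrefl refl)) ⟩
        1 * G j i + 0 + inner j ≡⟨ cong₂ _+_ (trans (+-identityʳ (1 * G j i)) (*-identityˡ (G j i))) (∑-outside-const (λ l → 𝟙 (l <? j)) (G j) Q row-j) ⟩
        G j i + outsideBelow j * Q ∎
      row-outside : ∀ k → Outside i j k → row k ≡ 𝟙 (i <? k) * Q + 𝟙 (j <? k) * P + inner k
      row-outside k o = trans (∑-split₂ i≢j (λ l → 𝟙 (l <? k) * G k l))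
        (cong₂ (λ x y → 𝟙 (i <? k) * x + 𝟙 (j <? k) * y + inner k) (column-i k o) (column-j k o))
      rows-outside : ∑[ k < n ] (out k * row k) ≡ outsideAbove i * Q + outsideAbove j * P + belowOutside G
      rows-outside = begin
        ∑[ k < n ] (out k * row k)
          ≡⟨ ∑-outside-cong row-outside ⟩
        ∑[ k < n ] (out k * (𝟙 (i <? k) * Q + 𝟙 (j <? k) * P + inner k))
          ≡⟨ ∑-cong (λ k → distribute (out k) (𝟙 (i <? k)) (𝟙 (j <? k)) (inner k) Q P) ⟩
        ∑[ k < n ] (out k * 𝟙 (i <? k) * Q + out k * 𝟙 (j <? k) * P + out k * inner k)
          ≡⟨ ∑-distrib-+ (λ k → out k * 𝟙 (i <? k) * Q + out k * 𝟙 (j <? k) * P) (λ k → out k * inner k) ⟩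
        ∑[ k < n ] (out k * 𝟙 (i <? k) * Q + out k * 𝟙 (j <? k) * P) + belowOutside G
          ≡⟨ cong (_+ belowOutside G) (∑-distrib-+ (λ k → out k * 𝟙 (i <? k) * Q) (λ k → out k * 𝟙 (j <? k) * P)) ⟩
        ∑[ k < n ] (out k * 𝟙 (i <? k) * Q) + ∑[ k < n ] (out k * 𝟙 (j <? k) * P) + belowOutside G
          ≡⟨ cong₂ (λ x y → x + y + belowOutside G) (sym (*-distribʳ-sum Q (λ k → out k * 𝟙 (i <? k)))) (sym (*-distribʳ-sum P (λ k → out k * 𝟙 (j <? k)))) ⟩
        outsideAbove i * Q + outsideAbove j * P + belowOutside G ∎
        where
        distribute : ∀ o x y z q p → o * (x * q + y * p + z) ≡ o * x * q + o * y * p + o * z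
        distribute = solve-∀

    belowOutside-flip : ∀ {G P Q} → Pattern G P Q → belowOutside (flip G) ≡ belowOutside G
    belowOutside-flip {G} shape = ∑-outside-cong λ k ok → ∑-outside-cong λ l ol → cong (𝟙 (l <? k) *_) (Pattern.symmetric shape l k ol ok)

    outsideBelow-i : outsideBelow i ≡ toℕ i
    outsideBelow-i = begin
      outsideBelow i ≡⟨ cong₂ (λ x y → x + y + outsideBelow i) (𝟙-no (i <? i) (<-irrefl refl)) (𝟙-no (j <? i) (λ j<i → <-asym i<j j<i)) ⟨
      𝟙 (i <? i) + 𝟙 (j <? i) + ∑[ l < n ] (out l * 𝟙 (l <? i)) ≡⟨ ∑-split₂ i≢j (λ l → 𝟙 (l <? i)) ⟨
      ∑[ l < n ] 𝟙 (l <? i) ≡⟨ ∑-𝟙-< i ⟩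
      toℕ i ∎
      where open ≡-Reasoning

    outsideBelow-j : suc (outsideBelow j) ≡ toℕ j
    outsideBelow-j = begin
      1 + 0 + outsideBelow j ≡⟨ cong₂ (λ x y → x + y + outsideBelow j) (𝟙-yes (i <? j) i<j) (𝟙-no (j <? j) (<-irrefl refl)) ⟨
      𝟙 (i <? j) + 𝟙 (j <? j) + outsideBelow j ≡⟨ ∑-split₂ i≢j (λ l → 𝟙 (l <? j)) ⟨
      ∑[ l < n ] 𝟙 (l <? j) ≡⟨ ∑-𝟙-< j ⟩
      toℕ j ∎
      where open ≡-Reasoning

    outsideAbove-i : suc (outsideAbove i) + suc (toℕ i) ≡ n
    outsideAbove-i = begin
      0 + 1 + outsideAbove i + suc (toℕ i)
        ≡⟨ cong₂ (λ x y → x + y + outsideAbove i + suc (toℕ i)) (𝟙-no (i <? i) (<-irrefl refl)) (𝟙-yes (i <? j) i<j) ⟨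
      𝟙 (i <? i) + 𝟙 (i <? j) + outsideAbove i + suc (toℕ i)
        ≡⟨ cong (_+ suc (toℕ i)) (∑-split₂ i≢j (λ l → 𝟙 (i <? l))) ⟨
      ∑[ l < n ] 𝟙 (i <? l) + suc (toℕ i) ≡⟨ ∑-𝟙-> i ⟩
      n ∎
      where open ≡-Reasoning

    outsideAbove-j : outsideAbove j + suc (toℕ j) ≡ n
    outsideAbove-j = begin
      0 + 0 + outsideAbove j + suc (toℕ j)
        ≡⟨ cong₂ (λ x y → x + y + outsideAbove j + suc (toℕ j)) (𝟙-no (j <? i) (λ j<i → <-asym i<j j<i)) (𝟙-no (j <? j) (<-irrefl refl)) ⟨
      𝟙 (j <? i) + 𝟙 (j <? j) + outsideAbove j + suc (toℕ j)
        ≡⟨ cong (_+ suc (toℕ j)) (∑-split₂ i≢j (λ l → 𝟙 (j <? l))) ⟨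
      ∑[ l < n ] 𝟙 (j <? l) + suc (toℕ j) ≡⟨ ∑-𝟙-> j ⟩
      n ∎
      where open ≡-Reasoning

    private
      d = toℕ j ∸ toℕ i ∸ 1

      toℕ-j : toℕ j ≡ suc (toℕ i + d)
      toℕ-j = begin
        toℕ j ≡⟨ m+[n∸m]≡n i<j ⟨
        suc (toℕ i) + (toℕ j ∸ suc (toℕ i)) ≡⟨ cong (λ k → suc (toℕ i) + (toℕ j ∸ k)) (+-comm 1 (toℕ i)) ⟩
        suc (toℕ i) + (toℕ j ∸ (toℕ i + 1)) ≡⟨ cong (λ k → suc (toℕ i) + k) (∸-+-assoc (toℕ j) (toℕ i) 1) ⟨
        suc (toℕ i + d) ∎
        where open ≡-Reasoning

      outsideBelow-j′ : outsideBelow j ≡ toℕ i + d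
      outsideBelow-j′ = suc-injective (trans outsideBelow-j toℕ-j)

      outsideAbove-i′ : outsideAbove i ≡ outsideAbove j + d
      outsideAbove-i′ = suc-injective (+-cancelʳ-≡ (suc (toℕ i)) _ _ (begin
        suc (outsideAbove i) + suc (toℕ i) ≡⟨ outsideAbove-i ⟩
        n ≡⟨ outsideAbove-j ⟨
        outsideAbove j + suc (toℕ j) ≡⟨ cong (λ t → outsideAbove j + suc t) toℕ-j ⟩
        outsideAbove j + suc (suc (toℕ i + d)) ≡⟨ shuffle (outsideAbove j) (toℕ i) d ⟩
        suc (outsideAbove j + d) + suc (toℕ i) ∎))
        where
        open ≡-Reasoning
        shuffle : ∀ b t d → b + suc (suc (t + d)) ≡ suc (b + d) + suc t
        shuffle = solve-∀

    below-in-positions : ∀ {G P Q} → Pattern G P Q →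
      below G ≡ toℕ i * P + (G j i + (toℕ i + d) * Q) + ((outsideAbove j + d) * Q + outsideAbove j * P + belowOutside G)
    below-in-positions {G} {P} {Q} shape = trans (below-decomposition shape)
      (cong₃ (λ a c e → a * P + (G j i + c * Q) + (e * Q + outsideAbove j * P + belowOutside G)) outsideBelow-i outsideBelow-j′ outsideAbove-i′)
      where
      cong₃ : ∀ (f : ℕ → ℕ → ℕ → ℕ) {x x′ y y′ z z′} → x ≡ x′ → y ≡ y′ → z ≡ z′ → f x y z ≡ f x′ y′ z′
      cong₃ f refl refl refl = refl

    below+below-flip : ∀ {G P Q} → Pattern G P Q → below G + below (flip G) ≡ total G
    below+below-flip {G} shape = begin
      below G + below (flip G)
        ≡⟨ cong (below G +_) (∑-comm (λ k l → 𝟙 (l <? k) * G l k)) ⟩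
      ∑[ k < n ] ∑[ l < n ] (𝟙 (l <? k) * G k l) + ∑[ k < n ] ∑[ l < n ] (𝟙 (k <? l) * G k l)
        ≡⟨ ∑-distrib-+ (λ k → ∑[ l < n ] (𝟙 (l <? k) * G k l)) (λ k → ∑[ l < n ] (𝟙 (k <? l) * G k l)) ⟨
      ∑[ k < n ] (∑[ l < n ] (𝟙 (l <? k) * G k l) + ∑[ l < n ] (𝟙 (k <? l) * G k l))
        ≡⟨ ∑-cong (λ k → ∑-distrib-+ (λ l → 𝟙 (l <? k) * G k l) (λ l → 𝟙 (k <? l) * G k l)) ⟨
      ∑[ k < n ] ∑[ l < n ] (𝟙 (l <? k) * G k l + 𝟙 (k <? l) * G k l)
        ≡⟨ ∑-cong (λ k → ∑-cong (λ l → split k l)) ⟩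
      total G ∎
      where
      open ≡-Reasoning
      split : ∀ k l → 𝟙 (l <? k) * G k l + 𝟙 (k <? l) * G k l ≡ G k l
      split k l with Finₚ.<-cmp k l
      ... | tri< k<l _ l≮k = trans (cong₂ (λ x y → x * G k l + y * G k l) (𝟙-no (l <? k) l≮k) (𝟙-yes (k <? l) k<l)) (+-identityʳ (G k l))
      ... | tri≈ _ refl _ = trans (cong₂ (λ x y → x * G k k + y * G k k) (𝟙-no (k <? k) (<-irrefl refl)) (𝟙-no (k <? k) (<-irrefl refl))) (sym (Pattern.diagonal shape k))
      ... | tri> k≮l _ l<k = trans (cong₂ (λ x y → x * G k l + y * G k l) (𝟙-yes (l <? k) l<k) (𝟙-no (k <? l) k≮l)) (trans (+-identityʳ (1 * G k l)) (*-identityˡ (G k l)))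

    pattern-identity : ∀ {G P Q} → Pattern G P Q → 2 * below G + G i j + 2 * d * P ≡ total G + G j i + 2 * d * Q
    pattern-identity {G} {P} {Q} shape = begin
      2 * below G + G i j + 2 * d * P
        ≡⟨ cong (λ x → 2 * x + G i j + 2 * d * P) (below-in-positions shape) ⟩
      2 * low + G i j + 2 * d * P
        ≡⟨ rearrange (toℕ i) d (outsideAbove j) P Q (belowOutside G) (G i j) (G j i) ⟩
      low + high + G j i + 2 * d * Q
        ≡⟨ cong₂ (λ x y → x + y + G j i + 2 * d * Q) (below-in-positions shape) (trans (below-in-positions (Pattern-flip shape)) (cong (λ z → toℕ i * Q + (G i j + (toℕ i + d) * P) + ((outsideAbove j + d) * P + outsideAbove j * Q + z)) (belowOutside-flip shape))) ⟨
      below G + below (flip G) + G j i + 2 * d * Q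
        ≡⟨ cong (λ x → x + G j i + 2 * d * Q) (below+below-flip shape) ⟩
      total G + G j i + 2 * d * Q ∎
      where
      open ≡-Reasoning
      low = toℕ i * P + (G j i + (toℕ i + d) * Q) + ((outsideAbove j + d) * Q + outsideAbove j * P + belowOutside G)
      high = toℕ i * Q + (G i j + (toℕ i + d) * P) + ((outsideAbove j + d) * P + outsideAbove j * Q + belowOutside G)
      rearrange : ∀ t d b P Q L Gij Gji →
        2 * (t * P + (Gji + (t + d) * Q) + ((b + d) * Q + b * P + L)) + Gij + 2 * d * P
          ≡ t * P + (Gji + (t + d) * Q) + ((b + d) * Q + b * P + L) + (t * Q + (Gij + (t + d) * P) + ((b + d) * P + b * Q + L)) + Gji + 2 * d * Q
      rearrange = solve-∀

  -- Counting elements of the class by their values at given points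

  module PairCounts (m : ℕ) (a : ℕ → ℕ) where

    n = suc (suc m)

    open Class n a public

    c : ℕ
    c = Σᶜ (λ _ → 1)

    M : Fin n → Fin n → ℕ
    M x k = Σᶜ (λ ω → 𝟙 (ω x ≟ k))

    N : Fin n → Fin n → Fin n → Fin n → ℕ
    N x y k l = Σᶜ (λ ω → 𝟙 (ω x ≟ k) * 𝟙 (ω y ≟ l))

    Two : Fin n → ℕ
    Two x = Σᶜ (λ ω → 𝟙 (ω (ω x) ≟ x))

    Inv : Fin n → Fin n → ℕ
    Inv x y = Σᶜ (λ ω → 𝟙 (ω y <? ω x))

    module _ (u v : Fin n) where

      private
        τ = transpose u v

      M-conj : ∀ x k → M (τ x) (τ k) ≡ M x k
      M-conj x k = trans
        (Σᶜ-cong λ ω _ → sym (𝟙-≟-transpose u v (ω (τ x)) k))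
        (Σᶜ-conj u v (λ ω → 𝟙 (ω x ≟ k)) λ e → cong (λ y → 𝟙 (y ≟ k)) (e x))

      N-conj : ∀ x y k l → N (τ x) (τ y) (τ k) (τ l) ≡ N x y k l
      N-conj x y k l = trans
        (Σᶜ-cong λ ω _ → sym (cong₂ _*_ (𝟙-≟-transpose u v (ω (τ x)) k) (𝟙-≟-transpose u v (ω (τ y)) l)))
        (Σᶜ-conj u v (λ ω → 𝟙 (ω x ≟ k) * 𝟙 (ω y ≟ l)) λ e → cong₂ (λ z w → 𝟙 (z ≟ k) * 𝟙 (w ≟ l)) (e x) (e y))

      Two-conj : ∀ x → Two (τ x) ≡ Two x
      Two-conj x = trans
        (Σᶜ-cong λ ω _ → trans (sym (𝟙-≟-transpose u v (ω (ω (τ x))) x))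
          (cong (λ z → 𝟙 (τ (ω z) ≟ x)) (sym (transpose-involutive u v (ω (τ x))))))
        (Σᶜ-conj u v (λ ω → 𝟙 (ω (ω x) ≟ x)) λ {f} {g} e → cong (λ z → 𝟙 (z ≟ x)) (trans (cong f (e x)) (e (g x))))

    N-swap : ∀ x y k l → N x y k l ≡ N y x l k
    N-swap x y k l = Σᶜ-cong λ ω _ → *-comm (𝟙 (ω x ≟ k)) (𝟙 (ω y ≟ l))

    N-diagonal : ∀ x → N x x x x ≡ M x x
    N-diagonal x = Σᶜ-cong λ ω _ → 𝟙-idem (ω x ≟ x)

    N-injective : ∀ {x y} → x ≢ y → ∀ k → N x y k k ≡ 0
    N-injective {x} {y} x≢y k = trans (Σᶜ-cong {H = λ _ → 0 * 0} collide) (Σᶜ-*ˡ 0 (λ _ → 0))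
      where
      collide : ∀ ω → InClass ω → 𝟙 (ω x ≟ k) * 𝟙 (ω y ≟ k) ≡ 0 * 0
      collide ω (inj , _) with ω x ≟ k | ω y ≟ k
      ... | yes ωx≡k | yes ωy≡k = ⊥-elim (x≢y (isInjective⁻ {ω = ω} inj (trans ωx≡k (sym ωy≡k))))
      ... | yes _ | no _ = refl
      ... | no _ | _ = refl

    ∑-M : ∀ x → ∑[ k < n ] M x k ≡ c
    ∑-M x = trans (sym (Σᶜ-∑ λ ω k → 𝟙 (ω x ≟ k))) (Σᶜ-cong λ ω _ → ∑-𝟙-≟-one (ω x))

    ∑-N : ∀ x y k → ∑[ l < n ] N x y k l ≡ M x k
    ∑-N x y k = trans (sym (Σᶜ-∑ λ ω l → 𝟙 (ω x ≟ k) * 𝟙 (ω y ≟ l))) (Σᶜ-cong λ ω _ → begin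
      ∑[ l < n ] (𝟙 (ω x ≟ k) * 𝟙 (ω y ≟ l)) ≡⟨ *-distribˡ-sum (𝟙 (ω x ≟ k)) (λ l → 𝟙 (ω y ≟ l)) ⟨
      𝟙 (ω x ≟ k) * ∑[ l < n ] 𝟙 (ω y ≟ l)   ≡⟨ cong (𝟙 (ω x ≟ k) *_) (∑-𝟙-≟-one (ω y)) ⟩
      𝟙 (ω x ≟ k) * 1                        ≡⟨ *-identityʳ _ ⟩
      𝟙 (ω x ≟ k) ∎)
      where open ≡-Reasoning

    total-N : ∀ x y → total (N x y) ≡ c
    total-N x y = trans (∑-cong (λ k → ∑-N x y k)) (∑-M x)

    ∑-M-diagonal : ∑[ x < n ] M x x ≡ a 1 * c
    ∑-M-diagonal = begin
      ∑[ x < n ] M x x                       ≡⟨ Σᶜ-∑ (λ ω x → 𝟙 (ω x ≟ x)) ⟨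
      Σᶜ (λ ω → ∑[ x < n ] 𝟙 (ω x ≟ x))     ≡⟨ Σᶜ-cong (λ ω (_ , ct) → trans (∑-fixedPoints a {ω} ct) (sym (*-identityʳ (a 1)))) ⟩
      Σᶜ (λ _ → a 1 * 1)                     ≡⟨ Σᶜ-*ˡ (a 1) (λ _ → 1) ⟩
      a 1 * c ∎
      where open ≡-Reasoning

    ∑-Two : ∑[ x < n ] Two x ≡ (a 1 + 2 * a 2) * c
    ∑-Two = begin
      ∑[ x < n ] Two x                         ≡⟨ Σᶜ-∑ (λ ω x → 𝟙 (ω (ω x) ≟ x)) ⟨
      Σᶜ (λ ω → ∑[ x < n ] 𝟙 (ω (ω x) ≟ x))   ≡⟨ Σᶜ-cong (λ ω (_ , ct) → trans (∑-squareFixedPoints a {ω} ct) (sym (*-identityʳ (a 1 + 2 * a 2)))) ⟩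
      Σᶜ (λ _ → (a 1 + 2 * a 2) * 1)           ≡⟨ Σᶜ-*ˡ (a 1 + 2 * a 2) (λ _ → 1) ⟩
      (a 1 + 2 * a 2) * c ∎
      where open ≡-Reasoning

    ∑-N-fixed : ∀ x → ∑[ l < n ] N x l x l ≡ a 1 * M x x
    ∑-N-fixed x = begin
      ∑[ l < n ] N x l x l                                 ≡⟨ Σᶜ-∑ (λ ω l → 𝟙 (ω x ≟ x) * 𝟙 (ω l ≟ l)) ⟨
      Σᶜ (λ ω → ∑[ l < n ] (𝟙 (ω x ≟ x) * 𝟙 (ω l ≟ l)))   ≡⟨ Σᶜ-cong (λ ω (_ , ct) → trans (sym (*-distribˡ-sum (𝟙 (ω x ≟ x)) (λ l → 𝟙 (ω l ≟ l))))
                                                               (trans (cong (𝟙 (ω x ≟ x) *_) (∑-fixedPoints a {ω} ct)) (*-comm (𝟙 (ω x ≟ x)) (a 1)))) ⟩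
      Σᶜ (λ ω → a 1 * 𝟙 (ω x ≟ x))                         ≡⟨ Σᶜ-*ˡ (a 1) (λ ω → 𝟙 (ω x ≟ x)) ⟩
      a 1 * M x x ∎
      where open ≡-Reasoning

    ∑-N-twice : ∀ x → ∑[ l < n ] N x l l x ≡ Two x
    ∑-N-twice x = trans (sym (Σᶜ-∑ (λ ω l → 𝟙 (ω x ≟ l) * 𝟙 (ω l ≟ x))))
      (Σᶜ-cong λ ω _ → ∑-𝟙-≟′ (ω x) (λ l → 𝟙 (ω l ≟ x)))

    Inv≡below : ∀ x y → Inv x y ≡ below (N x y)
    Inv≡below x y = sym (begin
      ∑[ k < n ] ∑[ l < n ] (𝟙 (l <? k) * N x y k l)
        ≡⟨ ∑-cong (λ k → ∑-cong (λ l → Σᶜ-*ˡ (𝟙 (l <? k)) (λ ω → 𝟙 (ω x ≟ k) * 𝟙 (ω y ≟ l)))) ⟨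
      ∑[ k < n ] ∑[ l < n ] Σᶜ (λ ω → 𝟙 (l <? k) * (𝟙 (ω x ≟ k) * 𝟙 (ω y ≟ l)))
        ≡⟨ ∑-cong (λ k → Σᶜ-∑ (λ ω l → 𝟙 (l <? k) * (𝟙 (ω x ≟ k) * 𝟙 (ω y ≟ l)))) ⟨
      ∑[ k < n ] Σᶜ (λ ω → ∑[ l < n ] (𝟙 (l <? k) * (𝟙 (ω x ≟ k) * 𝟙 (ω y ≟ l))))
        ≡⟨ Σᶜ-∑ (λ ω k → ∑[ l < n ] (𝟙 (l <? k) * (𝟙 (ω x ≟ k) * 𝟙 (ω y ≟ l)))) ⟨
      Σᶜ (λ ω → ∑[ k < n ] ∑[ l < n ] (𝟙 (l <? k) * (𝟙 (ω x ≟ k) * 𝟙 (ω y ≟ l))))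
        ≡⟨ Σᶜ-cong (λ ω _ → evaluate ω) ⟩
      Inv x y ∎)
      where
      open ≡-Reasoning
      evaluate : ∀ ω → ∑[ k < n ] ∑[ l < n ] (𝟙 (l <? k) * (𝟙 (ω x ≟ k) * 𝟙 (ω y ≟ l))) ≡ 𝟙 (ω y <? ω x)
      evaluate ω = begin
        ∑[ k < n ] ∑[ l < n ] (𝟙 (l <? k) * (𝟙 (ω x ≟ k) * 𝟙 (ω y ≟ l)))
          ≡⟨ ∑-cong (λ k → ∑-cong (λ l → regroup (𝟙 (l <? k)) (𝟙 (ω x ≟ k)) (𝟙 (ω y ≟ l)))) ⟩
        ∑[ k < n ] ∑[ l < n ] (𝟙 (ω x ≟ k) * (𝟙 (ω y ≟ l) * 𝟙 (l <? k)))
          ≡⟨ ∑-cong (λ k → *-distribˡ-sum (𝟙 (ω x ≟ k)) (λ l → 𝟙 (ω y ≟ l) * 𝟙 (l <? k))) ⟨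
        ∑[ k < n ] (𝟙 (ω x ≟ k) * ∑[ l < n ] (𝟙 (ω y ≟ l) * 𝟙 (l <? k)))
          ≡⟨ ∑-𝟙-≟′ (ω x) (λ k → ∑[ l < n ] (𝟙 (ω y ≟ l) * 𝟙 (l <? k))) ⟩
        ∑[ l < n ] (𝟙 (ω y ≟ l) * 𝟙 (l <? ω x))
          ≡⟨ ∑-𝟙-≟′ (ω y) (λ l → 𝟙 (l <? ω x)) ⟩
        𝟙 (ω y <? ω x) ∎
        where
        regroup : ∀ p q r → p * (q * r) ≡ q * (r * p)
        regroup p q r = trans (*-comm p (q * r)) (*-assoc q r p)

    module Pair {i j : Fin n} (i<j : i Fin.< j) {l₀ : Fin n} (l₀-outside : Outside i j l₀) where

      private
        i≢j = Finₚ.<⇒≢ i<j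
        j≢i = λ e → i≢j (sym e)
        d = toℕ j ∸ toℕ i ∸ 1

      Fx F2 T Mo Tw P1 P2 : ℕ
      Fx = M i i
      F2 = N i j i j
      T = N i j j i
      Mo = M i j
      Tw = Two i
      P1 = N i j i l₀
      P2 = N i j j l₀

      private
        transpose-fixes-i : ∀ {u v} → Outside i j u → Outside i j v → transpose u v i ≡ i
        transpose-fixes-i {u} {v} (u≢i , _) (v≢i , _) = transpose-fixes u v (≢-sym u≢i) (≢-sym v≢i)

        transpose-fixes-j : ∀ {u v} → Outside i j u → Outside i j v → transpose u v j ≡ j
        transpose-fixes-j {u} {v} (_ , u≢j) (_ , v≢j) = transpose-fixes u v (≢-sym u≢j) (≢-sym v≢j)

        N-conj-outside : ∀ {u v} → Outside i j u → Outside i j v → ∀ k l →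
          N i j (transpose u v k) (transpose u v l) ≡ N i j k l
        N-conj-outside {u} {v} ou ov k l = trans
          (cong₂ (λ x y → N x y (transpose u v k) (transpose u v l)) (sym (transpose-fixes-i ou ov)) (sym (transpose-fixes-j ou ov)))
          (N-conj u v i j k l)

        transpose-ij-l₀ : transpose i j l₀ ≡ l₀
        transpose-ij-l₀ = transpose-fixes i j (proj₁ l₀-outside) (proj₂ l₀-outside)

        l₀-column-j : N i j l₀ j ≡ P1
        l₀-column-j = begin
          N i j l₀ j ≡⟨ N-swap i j l₀ j ⟩
          N j i j l₀ ≡⟨ trans (cong₂ (λ x y → N x y x (transpose i j l₀)) (transpose-matchˡ i j) (transpose-matchʳ i j)) (cong (N j i j) transpose-ij-l₀) ⟨
          N (transpose i j i) (transpose i j j) (transpose i j i) (transpose i j l₀) ≡⟨ N-conj i j i j i l₀ ⟩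
          P1 ∎
          where open ≡-Reasoning

        l₀-column-i : N i j l₀ i ≡ P2
        l₀-column-i = begin
          N i j l₀ i ≡⟨ N-swap i j l₀ i ⟩
          N j i i l₀ ≡⟨ trans (cong₂ (λ x y → N x y y (transpose i j l₀)) (transpose-matchˡ i j) (transpose-matchʳ i j)) (cong (N j i i) transpose-ij-l₀) ⟨
          N (transpose i j i) (transpose i j j) (transpose i j j) (transpose i j l₀) ≡⟨ N-conj i j i j j l₀ ⟩
          P2 ∎
          where open ≡-Reasoning

      shape : Pattern i<j (N i j) P1 P2
      shape = record
        { diagonal = N-injective i≢j
        ; row-i = λ l o → trans (cong₂ (N i j) (sym (transpose-fixes-i l₀-outside o)) (sym (transpose-matchˡ l₀ l))) (N-conj-outside l₀-outside o i l₀)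
        ; column-j = λ k o → trans (cong₂ (N i j) (sym (transpose-matchˡ l₀ k)) (sym (transpose-fixes-j l₀-outside o))) (trans (N-conj-outside l₀-outside o l₀ j) l₀-column-j)
        ; row-j = λ l o → trans (cong₂ (N i j) (sym (transpose-fixes-j l₀-outside o)) (sym (transpose-matchˡ l₀ l))) (N-conj-outside l₀-outside o j l₀)
        ; column-i = λ k o → trans (cong₂ (N i j) (sym (transpose-matchˡ l₀ k)) (sym (transpose-fixes-i l₀-outside o))) (trans (N-conj-outside l₀-outside o l₀ i) l₀-column-i)
        ; symmetric = λ k l ok ol → sym (trans (cong₂ (N i j) (sym (transpose-matchˡ k l)) (sym (transpose-matchʳ k l))) (N-conj-outside ok ol k l))
        }

      private
        M-diagonal-const : ∀ x → M x x ≡ Fx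
        M-diagonal-const x = trans (cong (λ y → M y y) (sym (transpose-matchˡ i x))) (M-conj i x i i)

        Two-const : ∀ x → Two x ≡ Tw
        Two-const x = trans (cong Two (sym (transpose-matchˡ i x))) (Two-conj i x i)

        transpose-j-fixes-i : ∀ {l} → l ≢ i → transpose j l i ≡ i
        transpose-j-fixes-i l≢i = transpose-fixes j _ i≢j (≢-sym l≢i)

        F2-const : ∀ l → l ≢ i → N i l i l ≡ F2
        F2-const l l≢i = trans (cong₂ (λ x y → N x y x y) (sym (transpose-j-fixes-i l≢i)) (sym (transpose-matchˡ j l))) (N-conj j l i j i j)

        T-const : ∀ l → l ≢ i → N i l l i ≡ T
        T-const l l≢i = trans (cong₂ (λ x y → N x y y x) (sym (transpose-j-fixes-i l≢i)) (sym (transpose-matchˡ j l))) (N-conj j l i j j i)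

        Mo-const : ∀ k → k ≢ i → M i k ≡ Mo
        Mo-const k k≢i = trans (cong₂ M (sym (transpose-j-fixes-i k≢i)) (sym (transpose-matchˡ j k))) (M-conj j k i j)

      open ≡-Reasoning

      fixed : n * Fx ≡ a 1 * c
      fixed = begin
        n * Fx           ≡⟨ ∑-const n Fx ⟨
        ∑[ x < n ] Fx    ≡⟨ ∑-cong M-diagonal-const ⟨
        ∑[ x < n ] M x x ≡⟨ ∑-M-diagonal ⟩
        a 1 * c ∎

      fixed-pair : Fx + suc m * F2 ≡ a 1 * Fx
      fixed-pair = begin
        Fx + (F2 + m * F2)                         ≡⟨ +-assoc Fx F2 (m * F2) ⟨
        Fx + F2 + m * F2                           ≡⟨ cong (λ x → x + F2 + m * F2) (N-diagonal i) ⟨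
        N i i i i + N i j i j + m * F2             ≡⟨ ∑-split₂-const i≢j (λ l → N i l i l) F2 (λ l (l≢i , _) → F2-const l l≢i) ⟨
        ∑[ l < n ] N i l i l                       ≡⟨ ∑-N-fixed i ⟩
        a 1 * Fx ∎

      square-fixed : n * Tw ≡ (a 1 + 2 * a 2) * c
      square-fixed = begin
        n * Tw           ≡⟨ ∑-const n Tw ⟨
        ∑[ x < n ] Tw    ≡⟨ ∑-cong Two-const ⟨
        ∑[ x < n ] Two x ≡⟨ ∑-Two ⟩
        (a 1 + 2 * a 2) * c ∎

      square-fixed-pair : Fx + suc m * T ≡ Tw
      square-fixed-pair = begin
        Fx + (T + m * T)                           ≡⟨ +-assoc Fx T (m * T) ⟨
        Fx + T + m * T                             ≡⟨ cong (λ x → x + T + m * T) (N-diagonal i) ⟨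
        N i i i i + N i j j i + m * T              ≡⟨ ∑-split₂-const i≢j (λ l → N i l l i) T (λ l (l≢i , _) → T-const l l≢i) ⟨
        ∑[ l < n ] N i l l i                       ≡⟨ ∑-N-twice i ⟩
        Tw ∎

      image : Fx + suc m * Mo ≡ c
      image = begin
        Fx + (Mo + m * Mo)                         ≡⟨ +-assoc Fx Mo (m * Mo) ⟨
        M i i + M i j + m * Mo                     ≡⟨ ∑-split₂-const i≢j (M i) Mo (λ k (k≢i , _) → Mo-const k k≢i) ⟨
        ∑[ k < n ] M i k                           ≡⟨ ∑-M i ⟩
        c ∎

      row-i : F2 + m * P1 ≡ Fx
      row-i = begin
        F2 + m * P1                                ≡⟨ cong (λ x → x + F2 + m * P1) (N-injective i≢j i) ⟨
        N i j i i + N i j i j + m * P1             ≡⟨ ∑-split₂-const i≢j (N i j i) P1 (Pattern.row-i shape) ⟨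
        ∑[ l < n ] N i j i l                       ≡⟨ ∑-N i j i ⟩
        Fx ∎

      row-j : T + m * P2 ≡ Mo
      row-j = begin
        T + m * P2                                 ≡⟨ cong (_+ m * P2) (+-identityʳ T) ⟨
        T + 0 + m * P2                             ≡⟨ cong (λ x → T + x + m * P2) (N-injective i≢j j) ⟨
        T + N i j j j + m * P2                     ≡⟨ ∑-split₂-const i≢j (N i j j) P2 (Pattern.row-j shape) ⟨
        ∑[ l < n ] N i j j l                       ≡⟨ ∑-N i j j ⟩
        Mo ∎

      inversions : 2 * Inv i j + F2 + 2 * d * P1 ≡ c + T + 2 * d * P2
      inversions = begin
        2 * Inv i j + F2 + 2 * d * P1              ≡⟨ cong (λ x → 2 * x + F2 + 2 * d * P1) (Inv≡below i j) ⟩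
        2 * below (N i j) + F2 + 2 * d * P1        ≡⟨ pattern-identity i<j shape ⟩
        total (N i j) + T + 2 * d * P2             ≡⟨ cong (λ x → x + T + 2 * d * P2) (total-N i j) ⟩
        c + T + 2 * d * P2 ∎

-- From counts to probabilities

module _ where

  open Data.Rational using (_+_; _*_; _-_; toℚᵘ; fromℚᵘ)
  open ℚₚ using (toℚᵘ-injective; toℚᵘ-homo-+; toℚᵘ-homo-*; toℚᵘ-fromℚᵘ; *-zeroˡ; *-identityˡ)
  import Data.Integer as ℤ
  import Data.Integer.Properties as ℤₚ
  import Data.Rational.Unnormalised as ℚᵘ
  import Data.Rational.Unnormalised.Properties as ℚᵘₚ
  open import Tactic.RingSolver using (solve-∀; solve)
  open import Tactic.RingSolver.Core.AlmostCommutativeRing using (AlmostCommutativeRing; fromCommutativeRing)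
  open import Relation.Nullary.Decidable.Core using (dec⇒maybe)
  open import Level using (0ℓ)

  ℚ-ring : AlmostCommutativeRing 0ℓ 0ℓ
  ℚ-ring = fromCommutativeRing ℚₚ.+-*-commutativeRing (λ x → dec⇒maybe (0ℚ ℚₚ.≟ x))

  -- ℕ→ℚ k is by definition fromℚᵘ (k / 1)
  toℚᵘ-ℕ→ℚ : ∀ k → toℚᵘ (ℕ→ℚ k) ℚᵘ.≃ ℚᵘ.mkℚᵘ (ℤ.+ k) 0
  toℚᵘ-ℕ→ℚ k = toℚᵘ-fromℚᵘ (ℚᵘ.mkℚᵘ (ℤ.+ k) 0)

  ℕ→ℚ-+ : ∀ x y → ℕ→ℚ (x ℕ.+ y) ≡ ℕ→ℚ x + ℕ→ℚ y
  ℕ→ℚ-+ x y = toℚᵘ-injective (begin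
    toℚᵘ (ℕ→ℚ (x ℕ.+ y))                              ≈⟨ toℚᵘ-ℕ→ℚ (x ℕ.+ y) ⟩
    ℚᵘ.mkℚᵘ (ℤ.+ (x ℕ.+ y)) 0                            ≈⟨ ℚᵘ.*≡* (cong (ℤ._* ℤ.+ 1) (trans (ℤₚ.pos-+ x y) (sym (cong₂ ℤ._+_ (ℤₚ.*-identityʳ (ℤ.+ x)) (ℤₚ.*-identityʳ (ℤ.+ y)))))) ⟩
    ℚᵘ.mkℚᵘ (ℤ.+ x) 0 ℚᵘ.+ ℚᵘ.mkℚᵘ (ℤ.+ y) 0             ≈⟨ ℚᵘₚ.+-cong (toℚᵘ-ℕ→ℚ x) (toℚᵘ-ℕ→ℚ y) ⟨
    toℚᵘ (ℕ→ℚ x) ℚᵘ.+ toℚᵘ (ℕ→ℚ y)                    ≈⟨ toℚᵘ-homo-+ (ℕ→ℚ x) (ℕ→ℚ y) ⟨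
    toℚᵘ (ℕ→ℚ x + ℕ→ℚ y)                              ∎)
    where open ℚᵘₚ.≃-Reasoning

  ℕ→ℚ-suc : ∀ k → ℕ→ℚ (suc k) ≡ 1ℚ + ℕ→ℚ k
  ℕ→ℚ-suc = ℕ→ℚ-+ 1

  ℕ→ℚ-* : ∀ x y → ℕ→ℚ (x ℕ.* y) ≡ ℕ→ℚ x * ℕ→ℚ y
  ℕ→ℚ-* zero y = sym (*-zeroˡ (ℕ→ℚ y))
  ℕ→ℚ-* (suc x) y = begin
    ℕ→ℚ (y ℕ.+ x ℕ.* y)         ≡⟨ ℕ→ℚ-+ y (x ℕ.* y) ⟩
    ℕ→ℚ y + ℕ→ℚ (x ℕ.* y)       ≡⟨ cong (ℕ→ℚ y +_) (ℕ→ℚ-* x y) ⟩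
    ℕ→ℚ y + ℕ→ℚ x * ℕ→ℚ y       ≡⟨ factor (ℕ→ℚ x) (ℕ→ℚ y) ⟩
    (1ℚ + ℕ→ℚ x) * ℕ→ℚ y        ≡⟨ cong (_* ℕ→ℚ y) (ℕ→ℚ-suc x) ⟨
    ℕ→ℚ (suc x) * ℕ→ℚ y ∎
    where
    open ≡-Reasoning
    factor : ∀ a b → b + a * b ≡ (1ℚ + a) * b
    factor = solve-∀ ℚ-ring

  ℕ→ℚ-*-pred : ∀ k → ℕ→ℚ (k ℕ.* (k ℕ.∸ 1)) ≡ ℕ→ℚ k * (ℕ→ℚ k - 1ℚ)
  ℕ→ℚ-*-pred zero = refl
  ℕ→ℚ-*-pred (suc k) = begin
    ℕ→ℚ (suc k ℕ.* k)             ≡⟨ ℕ→ℚ-* (suc k) k ⟩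
    ℕ→ℚ (suc k) * ℕ→ℚ k           ≡⟨ cong (λ x → x * ℕ→ℚ k) (ℕ→ℚ-suc k) ⟩
    (1ℚ + ℕ→ℚ k) * ℕ→ℚ k          ≡⟨ cancel (ℕ→ℚ k) ⟩
    (1ℚ + ℕ→ℚ k) * ((1ℚ + ℕ→ℚ k) - 1ℚ) ≡⟨ cong (λ x → x * (x - 1ℚ)) (ℕ→ℚ-suc k) ⟨
    ℕ→ℚ (suc k) * (ℕ→ℚ (suc k) - 1ℚ) ∎
    where
    open ≡-Reasoning
    cancel : ∀ a → (1ℚ + a) * a ≡ (1ℚ + a) * ((1ℚ + a) - 1ℚ)
    cancel = solve-∀ ℚ-ring

  /ℕ≡*1/ℕ : ∀ x k → x /ℕ k ≡ x * (1ℚ /ℕ k)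
  /ℕ≡*1/ℕ x zero = sym (ℚₚ.*-zeroʳ x)
  /ℕ≡*1/ℕ x (suc k) = cong (x *_) (sym (*-identityˡ _))

  *-1/ℕ-inverse : ∀ k → ℕ→ℚ (suc k) * (1ℚ /ℕ suc k) ≡ 1ℚ
  *-1/ℕ-inverse k = trans (cong (ℕ→ℚ (suc k) *_) (*-identityˡ _)) (toℚᵘ-injective (begin
    toℚᵘ (ℕ→ℚ (suc k) * (ℤ.+ 1 Data.Rational./ suc k))                ≈⟨ toℚᵘ-homo-* (ℕ→ℚ (suc k)) _ ⟩
    toℚᵘ (ℕ→ℚ (suc k)) ℚᵘ.* toℚᵘ (fromℚᵘ (ℚᵘ.mkℚᵘ (ℤ.+ 1) k))        ≈⟨ ℚᵘₚ.*-cong (toℚᵘ-ℕ→ℚ (suc k)) (toℚᵘ-fromℚᵘ (ℚᵘ.mkℚᵘ (ℤ.+ 1) k)) ⟩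
    ℚᵘ.mkℚᵘ (ℤ.+ suc k) 0 ℚᵘ.* ℚᵘ.mkℚᵘ (ℤ.+ 1) k                      ≈⟨ ℚᵘ.*≡* (trans (ℤₚ.*-identityʳ _) (trans (ℤₚ.*-identityʳ (ℤ.+ suc k)) (sym (trans (ℤₚ.*-identityˡ _) (ℤₚ.*-identityˡ (ℤ.+ suc k)))))) ⟩
    ℚᵘ.1ℚᵘ ∎))
    where open ℚᵘₚ.≃-Reasoning

  inverse-unique : ∀ x r s → x * r ≡ 1ℚ → x * s ≡ 1ℚ → r ≡ s
  inverse-unique x r s xr≡1 xs≡1 = begin
    r             ≡⟨ solve (r ∷ []) ℚ-ring ⟩
    r * 1ℚ        ≡⟨ cong (r *_) xs≡1 ⟨
    r * (x * s)   ≡⟨ solve (x ∷ r ∷ s ∷ []) ℚ-ring ⟩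
    (x * r) * s   ≡⟨ cong (_* s) xr≡1 ⟩
    1ℚ * s        ≡⟨ solve (s ∷ []) ℚ-ring ⟩
    s ∎
    where open ≡-Reasoning

  1/ℕ-* : ∀ a b → 1ℚ /ℕ (suc a ℕ.* suc b) ≡ (1ℚ /ℕ suc a) * (1ℚ /ℕ suc b)
  1/ℕ-* a b = inverse-unique (ℕ→ℚ (suc a ℕ.* suc b)) _ _ (*-1/ℕ-inverse (b ℕ.+ a ℕ.* suc b)) (begin
    ℕ→ℚ (suc a ℕ.* suc b) * (ra * rb)   ≡⟨ cong (_* (ra * rb)) (ℕ→ℚ-* (suc a) (suc b)) ⟩
    ℕ→ℚ (suc a) * ℕ→ℚ (suc b) * (ra * rb) ≡⟨ regroup (ℕ→ℚ (suc a)) (ℕ→ℚ (suc b)) ra rb ⟩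
    (ℕ→ℚ (suc a) * ra) * (ℕ→ℚ (suc b) * rb) ≡⟨ cong₂ _*_ (*-1/ℕ-inverse a) (*-1/ℕ-inverse b) ⟩
    1ℚ * 1ℚ ≡⟨⟩
    1ℚ ∎)
    where
    open ≡-Reasoning
    ra = 1ℚ /ℕ suc a
    rb = 1ℚ /ℕ suc b
    regroup : ∀ x y r s → x * y * (r * s) ≡ (x * r) * (y * s)
    regroup = solve-∀ ℚ-ring

  *-1/ℕ-inverse′ : ∀ {k} → 1 ℕ.≤ k → ℕ→ℚ k * (1ℚ /ℕ k) ≡ 1ℚ
  *-1/ℕ-inverse′ {suc k} _ = *-1/ℕ-inverse k

  cross-divide : ∀ k s c rk rc p → k * s ≡ c * p → k * rk ≡ 1ℚ → c * rc ≡ 1ℚ → s * rc ≡ rk * p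
  cross-divide k s c rk rc p ks≡cp krk≡1 crc≡1 = begin
    s * rc                ≡⟨ solve (s ∷ rc ∷ []) ℚ-ring ⟩
    s * rc * 1ℚ           ≡⟨ cong (s * rc *_) krk≡1 ⟨
    s * rc * (k * rk)     ≡⟨ solve (s ∷ rc ∷ k ∷ rk ∷ []) ℚ-ring ⟩
    rk * rc * (k * s)     ≡⟨ cong (rk * rc *_) ks≡cp ⟩
    rk * rc * (c * p)     ≡⟨ solve (rk ∷ rc ∷ c ∷ p ∷ []) ℚ-ring ⟩
    rk * p * (c * rc)     ≡⟨ cong (rk * p *_) crc≡1 ⟩
    rk * p * 1ℚ           ≡⟨ solve (rk ∷ p ∷ []) ℚ-ring ⟩
    rk * p ∎
    where open ≡-Reasoning

  split-coefficients : ∀ {n n₁} m a1 a2 d {b} {r2 rn rn₁ rm} →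
    ℕ→ℚ 2 * r2 ≡ 1ℚ → n * rn ≡ 1ℚ → n₁ * rn₁ ≡ 1ℚ → m * rm ≡ 1ℚ →
    r2 * rn * rn₁ * rm * (n * n₁ * m + ℕ→ℚ 2 * m * a2 - m * a1 * (a1 - 1ℚ) + ℕ→ℚ 2 * d * b)
      ≡ (r2 + a2 * (rn * rn₁) - a1 * (a1 - 1ℚ) * (r2 * rn * rn₁)) + b * (rn * rn₁ * rm) * d
  split-coefficients {n} {n₁} m a1 a2 d {b} {r2} {rn} {rn₁} {rm} 2r2≡1 nrn≡1 n₁rn₁≡1 mrm≡1 = begin
    r2 * rn * rn₁ * rm * (n * n₁ * m + ℕ→ℚ 2 * m * a2 - m * a1 * (a1 - 1ℚ) + ℕ→ℚ 2 * d * b)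
      ≡⟨ solve (n ∷ n₁ ∷ m ∷ a1 ∷ a2 ∷ d ∷ b ∷ r2 ∷ rn ∷ rn₁ ∷ rm ∷ []) ℚ-ring ⟩
    r2 * (n * rn) * (n₁ * rn₁) * (m * rm) + a2 * (ℕ→ℚ 2 * r2) * (m * rm) * (rn * rn₁)
      - a1 * (a1 - 1ℚ) * (m * rm) * (r2 * rn * rn₁) + b * (ℕ→ℚ 2 * r2) * (rn * rn₁ * rm) * d
      ≡⟨⟩
    terms (n * rn) (n₁ * rn₁) (m * rm) (ℕ→ℚ 2 * r2)
      ≡⟨ cong₂ (λ x y → terms x y (m * rm) (ℕ→ℚ 2 * r2)) nrn≡1 n₁rn₁≡1 ⟩
    terms 1ℚ 1ℚ (m * rm) (ℕ→ℚ 2 * r2)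
      ≡⟨ cong₂ (terms 1ℚ 1ℚ) mrm≡1 2r2≡1 ⟩
    terms 1ℚ 1ℚ 1ℚ 1ℚ
      ≡⟨⟩
    r2 * 1ℚ * 1ℚ * 1ℚ + a2 * 1ℚ * 1ℚ * (rn * rn₁) - a1 * (a1 - 1ℚ) * 1ℚ * (r2 * rn * rn₁) + b * 1ℚ * (rn * rn₁ * rm) * d
      ≡⟨ solve (a1 ∷ a2 ∷ d ∷ b ∷ r2 ∷ rn ∷ rn₁ ∷ rm ∷ []) ℚ-ring ⟩
    (r2 + a2 * (rn * rn₁) - a1 * (a1 - 1ℚ) * (r2 * rn * rn₁)) + b * (rn * rn₁ * rm) * d ∎
    where
    open ≡-Reasoning
    terms : ℚ → ℚ → ℚ → ℚ → ℚ
    terms x y z w = r2 * x * y * z + a2 * w * z * (rn * rn₁) - a1 * (a1 - 1ℚ) * z * (r2 * rn * rn₁) + b * w * (rn * rn₁ * rm) * d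

  -- n = 2 + m throughout; the class has c elements, and for fixed i < j with j − i − 1 = d and a
  -- third point l: fx = #{ω(i) = i}, f2 = #{ω(i) = i, ω(j) = j}, t = #{ω(i) = j, ω(j) = i},
  -- tw = #{ω(ω(i)) = i}, mo = #{ω(i) = j}, p1 = #{ω(i) = i, ω(j) = l}, p2 = #{ω(i) = j, ω(j) = l},
  -- inv = #{ω(j) < ω(i)}.
  module InversionCount (m c fx f2 t tw mo p1 p2 inv d a1 a2 : ℚ) where

    record Relations : Set where
      field
        fixed : (1ℚ + (1ℚ + m)) * fx ≡ a1 * c
        fixed-pair : fx + (1ℚ + m) * f2 ≡ a1 * fx
        square-fixed : (1ℚ + (1ℚ + m)) * tw ≡ (a1 + ℕ→ℚ 2 * a2) * c
        square-fixed-pair : fx + (1ℚ + m) * t ≡ tw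
        image : fx + (1ℚ + m) * mo ≡ c
        row-i : f2 + m * p1 ≡ fx
        row-j : t + m * p2 ≡ mo
        inversions : ℕ→ℚ 2 * inv + f2 + ℕ→ℚ 2 * d * p1 ≡ c + t + ℕ→ℚ 2 * d * p2

    module _ (rel : Relations) where

      open Relations rel
      open ≡-Reasoning

      fixed-pair-count : (1ℚ + (1ℚ + m)) * (1ℚ + m) * f2 ≡ a1 * (a1 - 1ℚ) * c
      fixed-pair-count = begin
        (1ℚ + (1ℚ + m)) * (1ℚ + m) * f2              ≡⟨ solve (m ∷ fx ∷ f2 ∷ []) ℚ-ring ⟩
        (1ℚ + (1ℚ + m)) * (fx + (1ℚ + m) * f2) - (1ℚ + (1ℚ + m)) * fx ≡⟨ cong (λ z → (1ℚ + (1ℚ + m)) * z - (1ℚ + (1ℚ + m)) * fx) fixed-pair ⟩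
        (1ℚ + (1ℚ + m)) * (a1 * fx) - (1ℚ + (1ℚ + m)) * fx ≡⟨ solve (m ∷ fx ∷ a1 ∷ []) ℚ-ring ⟩
        (a1 - 1ℚ) * ((1ℚ + (1ℚ + m)) * fx)           ≡⟨ cong ((a1 - 1ℚ) *_) fixed ⟩
        (a1 - 1ℚ) * (a1 * c)                         ≡⟨ solve (a1 ∷ c ∷ []) ℚ-ring ⟩
        a1 * (a1 - 1ℚ) * c ∎

      transposition-count : (1ℚ + (1ℚ + m)) * (1ℚ + m) * t ≡ ℕ→ℚ 2 * a2 * c
      transposition-count = begin
        (1ℚ + (1ℚ + m)) * (1ℚ + m) * t               ≡⟨ solve (m ∷ fx ∷ t ∷ []) ℚ-ring ⟩
        (1ℚ + (1ℚ + m)) * (fx + (1ℚ + m) * t) - (1ℚ + (1ℚ + m)) * fx ≡⟨ cong₂ (λ y z → (1ℚ + (1ℚ + m)) * y - z) square-fixed-pair fixed ⟩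
        (1ℚ + (1ℚ + m)) * tw - a1 * c                ≡⟨ cong (_- a1 * c) square-fixed ⟩
        (a1 + ℕ→ℚ 2 * a2) * c - a1 * c               ≡⟨ solve (a1 ∷ a2 ∷ c ∷ []) ℚ-ring ⟩
        ℕ→ℚ 2 * a2 * c ∎

      image-count : (1ℚ + (1ℚ + m)) * (1ℚ + m) * mo ≡ ((1ℚ + (1ℚ + m)) - a1) * c
      image-count = begin
        (1ℚ + (1ℚ + m)) * (1ℚ + m) * mo              ≡⟨ solve (m ∷ fx ∷ mo ∷ []) ℚ-ring ⟩
        (1ℚ + (1ℚ + m)) * (fx + (1ℚ + m) * mo) - (1ℚ + (1ℚ + m)) * fx ≡⟨ cong₂ (λ y z → (1ℚ + (1ℚ + m)) * y - z) image fixed ⟩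
        (1ℚ + (1ℚ + m)) * c - a1 * c                 ≡⟨ solve (m ∷ a1 ∷ c ∷ []) ℚ-ring ⟩
        ((1ℚ + (1ℚ + m)) - a1) * c ∎

      gap-count : (1ℚ + (1ℚ + m)) * (1ℚ + m) * m * (p2 - p1) ≡ c * ((1ℚ + (1ℚ + m)) - (1ℚ + (1ℚ + m)) * a1 - a1 + a1 * a1 - ℕ→ℚ 2 * a2)
      gap-count = begin
        (1ℚ + (1ℚ + m)) * (1ℚ + m) * m * (p2 - p1)
          ≡⟨ solve (m ∷ p1 ∷ p2 ∷ f2 ∷ t ∷ []) ℚ-ring ⟩
        (1ℚ + (1ℚ + m)) * (1ℚ + m) * ((t + m * p2) - (f2 + m * p1) - t + f2)
          ≡⟨ cong₂ (λ y z → (1ℚ + (1ℚ + m)) * (1ℚ + m) * (y - z - t + f2)) row-j row-i ⟩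
        (1ℚ + (1ℚ + m)) * (1ℚ + m) * (mo - fx - t + f2)
          ≡⟨ solve (m ∷ mo ∷ fx ∷ t ∷ f2 ∷ []) ℚ-ring ⟩
        (1ℚ + (1ℚ + m)) * (1ℚ + m) * mo - (1ℚ + m) * ((1ℚ + (1ℚ + m)) * fx) - (1ℚ + (1ℚ + m)) * (1ℚ + m) * t + (1ℚ + (1ℚ + m)) * (1ℚ + m) * f2
          ≡⟨ cong₂ (λ y z → y - (1ℚ + m) * z - (1ℚ + (1ℚ + m)) * (1ℚ + m) * t + (1ℚ + (1ℚ + m)) * (1ℚ + m) * f2) image-count fixed ⟩
        ((1ℚ + (1ℚ + m)) - a1) * c - (1ℚ + m) * (a1 * c) - (1ℚ + (1ℚ + m)) * (1ℚ + m) * t + (1ℚ + (1ℚ + m)) * (1ℚ + m) * f2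
          ≡⟨ cong₂ (λ y z → ((1ℚ + (1ℚ + m)) - a1) * c - (1ℚ + m) * (a1 * c) - y + z) transposition-count fixed-pair-count ⟩
        ((1ℚ + (1ℚ + m)) - a1) * c - (1ℚ + m) * (a1 * c) - ℕ→ℚ 2 * a2 * c + a1 * (a1 - 1ℚ) * c
          ≡⟨ solve (m ∷ a1 ∷ a2 ∷ c ∷ []) ℚ-ring ⟩
        c * ((1ℚ + (1ℚ + m)) - (1ℚ + (1ℚ + m)) * a1 - a1 + a1 * a1 - ℕ→ℚ 2 * a2) ∎

      cleared : ℕ→ℚ 2 * (1ℚ + (1ℚ + m)) * (1ℚ + m) * m * inv
                ≡ c * ((1ℚ + (1ℚ + m)) * (1ℚ + m) * m + ℕ→ℚ 2 * m * a2 - m * a1 * (a1 - 1ℚ) + ℕ→ℚ 2 * d * ((1ℚ + (1ℚ + m)) - (1ℚ + (1ℚ + m)) * a1 - a1 + a1 * a1 - ℕ→ℚ 2 * a2))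
      cleared = begin
        ℕ→ℚ 2 * (1ℚ + (1ℚ + m)) * (1ℚ + m) * m * inv
          ≡⟨ solve (m ∷ inv ∷ f2 ∷ d ∷ p1 ∷ p2 ∷ []) ℚ-ring ⟩
        (1ℚ + (1ℚ + m)) * (1ℚ + m) * m * (ℕ→ℚ 2 * inv + f2 + ℕ→ℚ 2 * d * p1 - f2) - ℕ→ℚ 2 * d * ((1ℚ + (1ℚ + m)) * (1ℚ + m) * m * p1)
          ≡⟨ cong (λ y → (1ℚ + (1ℚ + m)) * (1ℚ + m) * m * (y - f2) - ℕ→ℚ 2 * d * ((1ℚ + (1ℚ + m)) * (1ℚ + m) * m * p1)) inversions ⟩
        (1ℚ + (1ℚ + m)) * (1ℚ + m) * m * (c + t + ℕ→ℚ 2 * d * p2 - f2) - ℕ→ℚ 2 * d * ((1ℚ + (1ℚ + m)) * (1ℚ + m) * m * p1)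
          ≡⟨ solve (m ∷ c ∷ t ∷ f2 ∷ d ∷ p1 ∷ p2 ∷ []) ℚ-ring ⟩
        (1ℚ + (1ℚ + m)) * (1ℚ + m) * m * c + m * ((1ℚ + (1ℚ + m)) * (1ℚ + m) * t) - m * ((1ℚ + (1ℚ + m)) * (1ℚ + m) * f2) + ℕ→ℚ 2 * d * ((1ℚ + (1ℚ + m)) * (1ℚ + m) * m * (p2 - p1))
          ≡⟨ cong₂ (λ y z → (1ℚ + (1ℚ + m)) * (1ℚ + m) * m * c + m * y - m * z + ℕ→ℚ 2 * d * ((1ℚ + (1ℚ + m)) * (1ℚ + m) * m * (p2 - p1))) transposition-count fixed-pair-count ⟩
        (1ℚ + (1ℚ + m)) * (1ℚ + m) * m * c + m * (ℕ→ℚ 2 * a2 * c) - m * (a1 * (a1 - 1ℚ) * c) + ℕ→ℚ 2 * d * ((1ℚ + (1ℚ + m)) * (1ℚ + m) * m * (p2 - p1))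
          ≡⟨ cong (λ y → (1ℚ + (1ℚ + m)) * (1ℚ + m) * m * c + m * (ℕ→ℚ 2 * a2 * c) - m * (a1 * (a1 - 1ℚ) * c) + ℕ→ℚ 2 * d * y) gap-count ⟩
        (1ℚ + (1ℚ + m)) * (1ℚ + m) * m * c + m * (ℕ→ℚ 2 * a2 * c) - m * (a1 * (a1 - 1ℚ) * c) + ℕ→ℚ 2 * d * (c * ((1ℚ + (1ℚ + m)) - (1ℚ + (1ℚ + m)) * a1 - a1 + a1 * a1 - ℕ→ℚ 2 * a2))
          ≡⟨ solve (m ∷ c ∷ a1 ∷ a2 ∷ d ∷ []) ℚ-ring ⟩
        c * ((1ℚ + (1ℚ + m)) * (1ℚ + m) * m + ℕ→ℚ 2 * m * a2 - m * a1 * (a1 - 1ℚ) + ℕ→ℚ 2 * d * ((1ℚ + (1ℚ + m)) - (1ℚ + (1ℚ + m)) * a1 - a1 + a1 * a1 - ℕ→ℚ 2 * a2)) ∎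

      divided : ∀ {r2 rn rn₁ rm rc} → ℕ→ℚ 2 * r2 ≡ 1ℚ → (1ℚ + (1ℚ + m)) * rn ≡ 1ℚ → (1ℚ + m) * rn₁ ≡ 1ℚ → m * rm ≡ 1ℚ → c * rc ≡ 1ℚ →
        inv * rc ≡ (r2 + a2 * (rn * rn₁) - a1 * (a1 - 1ℚ) * (r2 * rn * rn₁)) + ((1ℚ + (1ℚ + m)) - (1ℚ + (1ℚ + m)) * a1 - a1 + a1 * a1 - ℕ→ℚ 2 * a2) * (rn * rn₁ * rm) * d
      divided {r2} {rn} {rn₁} {rm} {rc} 2r2≡1 nrn≡1 n₁rn₁≡1 mrm≡1 crc≡1 =
        trans (cross-divide (ℕ→ℚ 2 * (1ℚ + (1ℚ + m)) * (1ℚ + m) * m) inv c (r2 * rn * rn₁ * rm) rc P cleared product-inverse crc≡1)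
              (split-coefficients {1ℚ + (1ℚ + m)} {1ℚ + m} m a1 a2 d {(1ℚ + (1ℚ + m)) - (1ℚ + (1ℚ + m)) * a1 - a1 + a1 * a1 - ℕ→ℚ 2 * a2} {r2} {rn} {rn₁} {rm} 2r2≡1 nrn≡1 n₁rn₁≡1 mrm≡1)
        where
        P = (1ℚ + (1ℚ + m)) * (1ℚ + m) * m + ℕ→ℚ 2 * m * a2 - m * a1 * (a1 - 1ℚ) + ℕ→ℚ 2 * d * ((1ℚ + (1ℚ + m)) - (1ℚ + (1ℚ + m)) * a1 - a1 + a1 * a1 - ℕ→ℚ 2 * a2)
        product-inverse : ℕ→ℚ 2 * (1ℚ + (1ℚ + m)) * (1ℚ + m) * m * (r2 * rn * rn₁ * rm) ≡ 1ℚ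
        product-inverse = trans (regroup (ℕ→ℚ 2) (1ℚ + (1ℚ + m)) (1ℚ + m) m r2 rn rn₁ rm) (cong₂ _*_ (cong₂ _*_ 2r2≡1 nrn≡1) (cong₂ _*_ n₁rn₁≡1 mrm≡1))
          where
          regroup : ∀ w x y z r s t u → w * x * y * z * (r * s * t * u) ≡ (w * r) * (x * s) * ((y * t) * (z * u))
          regroup = solve-∀ ℚ-ring

  cast : ∀ {x y : ℕ} {p q : ℚ} → x ≡ y → ℕ→ℚ x ≡ p → ℕ→ℚ y ≡ q → p ≡ q
  cast x≡y x≡p y≡q = trans (sym x≡p) (trans (cong ℕ→ℚ x≡y) y≡q)

  module _ (m′ : ℕ) (a : ℕ → ℕ) (partition : IsPartitionOf a (suc (suc (suc m′)))) where

    open PairCounts (suc m′) a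

    private
      m = suc m′
      ⟦_⟧ = ℕ→ℚ
      ⟦n⟧ : ⟦ n ⟧ ≡ 1ℚ + (1ℚ + ⟦ m ⟧)
      ⟦n⟧ = trans (ℕ→ℚ-suc (suc m)) (cong (1ℚ +_) (ℕ→ℚ-suc m))
      ⟦n-1⟧ : ⟦ suc m ⟧ ≡ 1ℚ + ⟦ m ⟧
      ⟦n-1⟧ = ℕ→ℚ-suc m

      c-positive : 1 ≤ c
      c-positive = Σᶜ-1-positive {proj₁ (permutationOfType n a partition)} (proj₂ (permutationOfType n a partition))

    inversion-probability : ∀ {i j : Fin n} → i Fin.< j →
      ⟦ Inv i j ⟧ /ℕ c ≡
        ((⟦ 1 ⟧ /ℕ 2) + (⟦ a 2 ⟧ /ℕ (n ℕ.* (n ∸ 1))) - (⟦ a 1 ℕ.* (a 1 ∸ 1) ⟧ /ℕ (2 ℕ.* n ℕ.* (n ∸ 1))))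
        + (⟦ n ⟧ - ⟦ n ℕ.* a 1 ⟧ - ⟦ a 1 ⟧ + ⟦ a 1 ℕ.* a 1 ⟧ - ⟦ 2 ℕ.* a 2 ⟧) /ℕ (n ℕ.* (n ∸ 1) ℕ.* (n ∸ 2)) * ⟦ toℕ j ∸ toℕ i ∸ 1 ⟧
    inversion-probability {i} {j} i<j = begin
      ⟦ Inv i j ⟧ /ℕ c                                    ≡⟨ /ℕ≡*1/ℕ ⟦ Inv i j ⟧ c ⟩
      ⟦ Inv i j ⟧ * (1ℚ /ℕ c)                             ≡⟨ Counts.divided relations (*-1/ℕ-inverse 1) n-inverse n-1-inverse (*-1/ℕ-inverse m′) (*-1/ℕ-inverse′ c-positive) ⟩
      (r2 + ⟦ a 2 ⟧ * (rn * rn₁) - ⟦ a 1 ⟧ * (⟦ a 1 ⟧ - 1ℚ) * (r2 * rn * rn₁)) + numerator * (rn * rn₁ * rm) * ⟦ d ⟧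
                                                            ≡⟨ cong₂ (λ x y → x + y * ⟦ d ⟧) A-form B-form ⟨
      _ ∎
      where
      open ≡-Reasoning
      open Pair i<j (proj₂ (outsidePoint i j))
      d = toℕ j ∸ toℕ i ∸ 1
      r2 = 1ℚ /ℕ 2
      rn = 1ℚ /ℕ n
      rn₁ = 1ℚ /ℕ suc m
      rm = 1ℚ /ℕ m
      numerator = (1ℚ + (1ℚ + ⟦ m ⟧)) - (1ℚ + (1ℚ + ⟦ m ⟧)) * ⟦ a 1 ⟧ - ⟦ a 1 ⟧ + ⟦ a 1 ⟧ * ⟦ a 1 ⟧ - ⟦ 2 ⟧ * ⟦ a 2 ⟧

      n-inverse : (1ℚ + (1ℚ + ⟦ m ⟧)) * rn ≡ 1ℚ
      n-inverse = trans (cong (_* rn) (sym ⟦n⟧)) (*-1/ℕ-inverse (suc m))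

      n-1-inverse : (1ℚ + ⟦ m ⟧) * rn₁ ≡ 1ℚ
      n-1-inverse = trans (cong (_* rn₁) (sym ⟦n-1⟧)) (*-1/ℕ-inverse m)

      ⟦x+suc-m*y⟧ : ∀ x y → ⟦ x ℕ.+ suc m ℕ.* y ⟧ ≡ ⟦ x ⟧ + (1ℚ + ⟦ m ⟧) * ⟦ y ⟧
      ⟦x+suc-m*y⟧ x y = trans (ℕ→ℚ-+ x (suc m ℕ.* y)) (cong (⟦ x ⟧ +_) (trans (ℕ→ℚ-* (suc m) y) (cong (_* ⟦ y ⟧) ⟦n-1⟧)))

      ⟦x+m*y⟧ : ∀ x y → ⟦ x ℕ.+ m ℕ.* y ⟧ ≡ ⟦ x ⟧ + ⟦ m ⟧ * ⟦ y ⟧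
      ⟦x+m*y⟧ x y = trans (ℕ→ℚ-+ x (m ℕ.* y)) (cong (⟦ x ⟧ +_) (ℕ→ℚ-* m y))

      ⟦n*x⟧ : ∀ x → ⟦ n ℕ.* x ⟧ ≡ (1ℚ + (1ℚ + ⟦ m ⟧)) * ⟦ x ⟧
      ⟦n*x⟧ x = trans (ℕ→ℚ-* n x) (cong (_* ⟦ x ⟧) ⟦n⟧)

      ⟦x+2dy⟧ : ∀ x y → ⟦ x ℕ.+ 2 ℕ.* d ℕ.* y ⟧ ≡ ⟦ x ⟧ + ⟦ 2 ⟧ * ⟦ d ⟧ * ⟦ y ⟧
      ⟦x+2dy⟧ x y = trans (ℕ→ℚ-+ x (2 ℕ.* d ℕ.* y)) (cong (⟦ x ⟧ +_) (trans (ℕ→ℚ-* (2 ℕ.* d) y) (cong (_* ⟦ y ⟧) (ℕ→ℚ-* 2 d))))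

      module Counts = InversionCount ⟦ m ⟧ ⟦ c ⟧ ⟦ Fx ⟧ ⟦ F2 ⟧ ⟦ T ⟧ ⟦ Tw ⟧ ⟦ Mo ⟧ ⟦ P1 ⟧ ⟦ P2 ⟧ ⟦ Inv i j ⟧ ⟦ d ⟧ ⟦ a 1 ⟧ ⟦ a 2 ⟧

      relations : Counts.Relations
      relations = record
        { fixed = cast fixed (⟦n*x⟧ Fx) (ℕ→ℚ-* (a 1) c)
        ; fixed-pair = cast fixed-pair (⟦x+suc-m*y⟧ Fx F2) (ℕ→ℚ-* (a 1) Fx)
        ; square-fixed = cast square-fixed (⟦n*x⟧ Tw) (trans (ℕ→ℚ-* (a 1 ℕ.+ 2 ℕ.* a 2) c) (cong (_* ⟦ c ⟧) (trans (ℕ→ℚ-+ (a 1) (2 ℕ.* a 2)) (cong (⟦ a 1 ⟧ +_) (ℕ→ℚ-* 2 (a 2))))))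
        ; square-fixed-pair = cast square-fixed-pair (⟦x+suc-m*y⟧ Fx T) refl
        ; image = cast image (⟦x+suc-m*y⟧ Fx Mo) refl
        ; row-i = cast row-i (⟦x+m*y⟧ F2 P1) refl
        ; row-j = cast row-j (⟦x+m*y⟧ T P2) refl
        ; inversions = cast inversions
            (trans (⟦x+2dy⟧ (2 ℕ.* Inv i j ℕ.+ F2) P1) (cong (λ x → x + ⟦ 2 ⟧ * ⟦ d ⟧ * ⟦ P1 ⟧) (trans (ℕ→ℚ-+ (2 ℕ.* Inv i j) F2) (cong (_+ ⟦ F2 ⟧) (ℕ→ℚ-* 2 (Inv i j))))))
            (trans (⟦x+2dy⟧ (c ℕ.+ T) P2) (cong (λ x → x + ⟦ 2 ⟧ * ⟦ d ⟧ * ⟦ P2 ⟧) (ℕ→ℚ-+ c T)))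
        }

      -- 2 * n and n * (n ∸ 1) reduce to suc (suc m + (n + 0)) and suc (m + suc m * suc m)
      A-form : (⟦ 1 ⟧ /ℕ 2) + (⟦ a 2 ⟧ /ℕ (n ℕ.* (n ∸ 1))) - (⟦ a 1 ℕ.* (a 1 ∸ 1) ⟧ /ℕ (2 ℕ.* n ℕ.* (n ∸ 1)))
               ≡ r2 + ⟦ a 2 ⟧ * (rn * rn₁) - ⟦ a 1 ⟧ * (⟦ a 1 ⟧ - 1ℚ) * (r2 * rn * rn₁)
      A-form = cong₂ _-_ (cong₂ _+_ (trans (/ℕ≡*1/ℕ ⟦ 1 ⟧ 2) (*-identityˡ r2)) (trans (/ℕ≡*1/ℕ ⟦ a 2 ⟧ (n ℕ.* (n ∸ 1))) (cong (⟦ a 2 ⟧ *_) (1/ℕ-* (suc m) m))))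
        (trans (/ℕ≡*1/ℕ ⟦ a 1 ℕ.* (a 1 ∸ 1) ⟧ (2 ℕ.* n ℕ.* (n ∸ 1))) (cong₂ _*_ (ℕ→ℚ-*-pred (a 1)) (trans (1/ℕ-* (suc m ℕ.+ (n ℕ.+ 0)) m) (cong (_* rn₁) (1/ℕ-* 1 (suc m))))))

      B-form : (⟦ n ⟧ - ⟦ n ℕ.* a 1 ⟧ - ⟦ a 1 ⟧ + ⟦ a 1 ℕ.* a 1 ⟧ - ⟦ 2 ℕ.* a 2 ⟧) /ℕ (n ℕ.* (n ∸ 1) ℕ.* (n ∸ 2))
               ≡ numerator * (rn * rn₁ * rm)
      B-form = trans (/ℕ≡*1/ℕ (⟦ n ⟧ - ⟦ n ℕ.* a 1 ⟧ - ⟦ a 1 ⟧ + ⟦ a 1 ℕ.* a 1 ⟧ - ⟦ 2 ℕ.* a 2 ⟧) (n ℕ.* (n ∸ 1) ℕ.* (n ∸ 2))) (cong₂ _*_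
        (cong₂ _-_ (cong₂ (λ x y → x - ⟦ a 1 ⟧ + y) (cong₂ _-_ ⟦n⟧ (⟦n*x⟧ (a 1))) (ℕ→ℚ-* (a 1) (a 1))) (ℕ→ℚ-* 2 (a 2)))
        (trans (1/ℕ-* (m ℕ.+ suc m ℕ.* suc m) m′) (cong (_* rm) (1/ℕ-* (suc m) m))))

  ℚΣ-ℕ→ℚ : ∀ {a} {A : Set a} (xs : List A) (f : A → ℕ) → ℚΣ.∑ˡ xs (λ x → ℕ→ℚ (f x)) ≡ ℕ→ℚ (ℕΣ.∑ˡ xs f)
  ℚΣ-ℕ→ℚ [] f = refl
  ℚΣ-ℕ→ℚ (x ∷ xs) f = trans (cong (ℕ→ℚ (f x) +_) (ℚΣ-ℕ→ℚ xs f)) (sym (ℕ→ℚ-+ (f x) (ℕΣ.∑ˡ xs f)))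

  I≡𝟙 : ∀ {n} (i j : Fin n) (ω : Fin n → Fin n) → I i j ω ≡ ℕ→ℚ (𝟙 (ω j <? ω i))
  I≡𝟙 i j ω with ω j <? ω i
  ... | yes _ = refl
  ... | no _ = refl

  module _ (m : ℕ) (a : ℕ → ℕ) (wt : Fin (suc (suc m)) → Fin (suc (suc m)) → ℚ) where

    open PairCounts m a

    private
      CC = ConjClass n a

    ∑-X : ℚΣ.∑ˡ CC (X wt) ≡ ℚΣ.∑ˡ (pairs n) (λ p → wt (proj₁ p) (proj₂ p) * ℕ→ℚ (Inv (proj₁ p) (proj₂ p)))
    ∑-X = trans (ℚΣ.∑ˡ-comm CC (pairs n) _) (ℚΣ.∑ˡ-cong (pairs n) λ { (i , j) → begin
      ℚΣ.∑ˡ CC (λ ω → wt i j * I i j ω)              ≡⟨ ℚΣ.∑ˡ-*ˡ CC (wt i j) (I i j) ⟩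
      wt i j * ℚΣ.∑ˡ CC (I i j)                      ≡⟨ cong (wt i j *_) (ℚΣ.∑ˡ-cong CC (I≡𝟙 i j)) ⟩
      wt i j * ℚΣ.∑ˡ CC (λ ω → ℕ→ℚ (𝟙 (ω j <? ω i))) ≡⟨ cong (wt i j *_) (ℚΣ-ℕ→ℚ CC (λ ω → 𝟙 (ω j <? ω i))) ⟩
      wt i j * ℕ→ℚ (Inv i j) ∎ })
      where open ≡-Reasoning

    expectation-as-∑-pairs : Eλ n a (X wt) ≡ ℚΣ.∑ˡ (pairs n) (λ p → wt (proj₁ p) (proj₂ p) * (ℕ→ℚ (Inv (proj₁ p) (proj₂ p)) /ℕ c))
    expectation-as-∑-pairs = begin
      ℚΣ.∑ˡ CC (X wt) /ℕ length (map (X wt) CC)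
        ≡⟨ cong (ℚΣ.∑ˡ CC (X wt) /ℕ_) (trans (length-map (X wt) CC) (length≡∑ˡ CC)) ⟩
      ℚΣ.∑ˡ CC (X wt) /ℕ c
        ≡⟨ trans (cong (_/ℕ c) ∑-X) (/ℕ≡*1/ℕ (ℚΣ.∑ˡ (pairs n) weighted) c) ⟩
      ℚΣ.∑ˡ (pairs n) weighted * (1ℚ /ℕ c)
        ≡⟨ ℚΣ.∑ˡ-*ʳ (pairs n) (1ℚ /ℕ c) weighted ⟨
      ℚΣ.∑ˡ (pairs n) (λ p → weighted p * (1ℚ /ℕ c))
        ≡⟨ ℚΣ.∑ˡ-cong (pairs n) (λ p → trans (ℚₚ.*-assoc (w p) _ _) (cong (w p *_) (sym (/ℕ≡*1/ℕ (ℕ→ℚ (Inv (proj₁ p) (proj₂ p))) c)))) ⟩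
      ℚΣ.∑ˡ (pairs n) (λ p → w p * (ℕ→ℚ (Inv (proj₁ p) (proj₂ p)) /ℕ c)) ∎
      where
      open ≡-Reasoning
      w : Fin n × Fin n → ℚ
      w p = wt (proj₁ p) (proj₂ p)
      weighted : Fin n × Fin n → ℚ
      weighted p = w p * ℕ→ℚ (Inv (proj₁ p) (proj₂ p))

  ∑-affine : ∀ {a} {A : Set a} (xs : List A) (w g : A → ℚ) (s t : ℚ) →
    ℚΣ.∑ˡ xs (λ x → w x * (s + t * g x)) ≡ s * ℚΣ.∑ˡ xs w + t * ℚΣ.∑ˡ xs (λ x → g x * w x)
  ∑-affine xs w g s t = begin
    ℚΣ.∑ˡ xs (λ x → w x * (s + t * g x))
      ≡⟨ ℚΣ.∑ˡ-cong xs (λ x → distribute (w x) s t (g x)) ⟩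
    ℚΣ.∑ˡ xs (λ x → s * w x + t * (g x * w x))
      ≡⟨ ℚΣ.∑ˡ-+ xs (λ x → s * w x) (λ x → t * (g x * w x)) ⟩
    ℚΣ.∑ˡ xs (λ x → s * w x) + ℚΣ.∑ˡ xs (λ x → t * (g x * w x))
      ≡⟨ cong₂ _+_ (ℚΣ.∑ˡ-*ˡ xs s w) (ℚΣ.∑ˡ-*ˡ xs t (λ x → g x * w x)) ⟩
    s * ℚΣ.∑ˡ xs w + t * ℚΣ.∑ˡ xs (λ x → g x * w x) ∎
    where
    open ≡-Reasoning
    distribute : ∀ x y z u → x * (y + z * u) ≡ y * x + z * (u * x)
    distribute = solve-∀ ℚ-ring

open Data.Rational using (_+_; _*_; _-_)

theorem4p8 : (n : ℕ) → 3 ≤ n → (a : ℕ → ℕ) → IsPartitionOf a n →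
    (wt : Fin n → Fin n → ℚ) →
    Eλ n a (X wt) ≡
      ((ℕ→ℚ 1 /ℕ 2) + (ℕ→ℚ (a 2) /ℕ (n Data.Nat.* (n ∸ 1)))
         - (ℕ→ℚ (a 1 Data.Nat.* (a 1 ∸ 1)) /ℕ (2 Data.Nat.* n Data.Nat.* (n ∸ 1)))) * α wt
      + (((ℕ→ℚ n - ℕ→ℚ (n Data.Nat.* a 1) - ℕ→ℚ (a 1) + ℕ→ℚ (a 1 Data.Nat.* a 1) - ℕ→ℚ (2 Data.Nat.* a 2))
           /ℕ (n Data.Nat.* (n ∸ 1) Data.Nat.* (n ∸ 2))) * β wt)
theorem4p8 (suc (suc (suc m))) (s≤s (s≤s (s≤s _))) a partition wt = begin
  Eλ n a (X wt)
    ≡⟨ expectation-as-∑-pairs (suc m) a wt ⟩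
  ℚΣ.∑ˡ (pairs n) (λ p → w p * (ℕ→ℚ (Inv (proj₁ p) (proj₂ p)) /ℕ c))
    -- with f and g left implicit, Agda would unfold ℚ arithmetic along the concrete list pairs n
    ≡⟨ ℚΣ.∑ˡ-cong-∈ (pairs n) {f = λ p → w p * (ℕ→ℚ (Inv (proj₁ p) (proj₂ p)) /ℕ c)} {g = λ p → w p * (A + B * gap p)}
         (λ { {i , j} ij∈ → cong (wt i j *_) (inversion-probability m a partition (∈-pairs⁻ ij∈)) }) ⟩
  ℚΣ.∑ˡ (pairs n) (λ p → w p * (A + B * gap p))
    ≡⟨ ∑-affine (pairs n) w gap A B ⟩
  A * α wt + B * β wt ∎
  where
  open ≡-Reasoning
  open PairCounts (suc m) a
  w gap : Fin n × Fin n → ℚ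
  w p = wt (proj₁ p) (proj₂ p)
  gap p = ℕ→ℚ (toℕ (proj₂ p) ∸ toℕ (proj₁ p) ∸ 1)
  A B : ℚ
  A = (ℕ→ℚ 1 /ℕ 2) + (ℕ→ℚ (a 2) /ℕ (n Data.Nat.* (n ∸ 1))) - (ℕ→ℚ (a 1 Data.Nat.* (a 1 ∸ 1)) /ℕ (2 Data.Nat.* n Data.Nat.* (n ∸ 1)))
  B = (ℕ→ℚ n - ℕ→ℚ (n Data.Nat.* a 1) - ℕ→ℚ (a 1) + ℕ→ℚ (a 1 Data.Nat.* a 1) - ℕ→ℚ (2 Data.Nat.* a 2)) /ℕ (n Data.Nat.* (n ∸ 1) Data.Nat.* (n ∸ 2))
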